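{- Let $b_{1,n}$ be the total number of vertices of rank $1$ in all labeled plane 1-2 trees on vertex set $[n]$, let $B_1(z)=\sum_{n\ge0}b_{1,n}\frac{z^n}{n!}$, and let $B(z)=\sum_{n\ge0}b_n\frac{z^n}{n!}$ where $b_n$ is the number of labeled plane 1-2 trees on $[n]$ and $b_0=1$. Then $B_1$ satisfies \[B_1'(z)=2B_1(z)(B(z)-1)+B_1(z)+2z(B(z)-1)+z-z^2,\qquad B_1(0)=0,\] and consequently \[B_1(z)=\frac{6z^3+\sqrt3(3z^2-15z-5)\sin(\sqrt3 z)+3(3z^2+5z-5)\cos(\sqrt3 z)+15}{9\left(\sqrt3\sin(\sqrt3 z)-\cos(\sqrt3 z)-2\right)}.\]
   Context: A labeled plane 1-2 tree on vertex set $[n]=\{1,\dots,n\}$ is a rooted tree whose vertices are bijectively labeled by $[n]$, in which every vertex has at most two children, the label of each non-root vertex is less than the label of its parent, and the children of each vertex are linearly ordered. The rank of a vertex $v$ is the number of edges in a shortest path from $v$ to a leaf that is a descendant of $v$ (leaves have rank $0$). One has $B(z)=\frac12+\frac{\sqrt3}{2}\tan\left(\frac{\sqrt3}{2}z+\frac{\pi}{6}\right)$. -}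

module Defs where

open import Data.Nat as ℕ using (ℕ; zero; suc; _<_; _⊓_; _!)
open import Data.Nat.Combinatorics using (_C_)
open import Data.Integer as ℤ using (ℤ; +_; -_)
open import Data.List using (List; []; _∷_; _++_; map; upTo; length)
open import Data.Nat.ListAction using (sum)
open import Data.List.Relation.Binary.Permutation.Propositional using (_↭_)
open import Data.List.Relation.Unary.Unique.Propositional using (Unique)
open import Data.List.Membership.Propositional using (_∈_)
open import Data.Product using (_×_)
open import Data.Unit using (⊤)
open import Function.Bundles using (_⇔_)

-- Plane 1-2 trees with natural-number labels.
-- leaf l       : vertex labelled l with no children
-- unary l c    : vertex labelled l with one child c
-- binary l c d : vertex labelled l with ordered children c (first), d (second)

data Tree : Set where
  leaf   : ℕ → Tree
  unary  : ℕ → Tree → Tree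
  binary : ℕ → Tree → Tree → Tree

label : Tree → ℕ
label (leaf l)       = l
label (unary l _)    = l
label (binary l _ _) = l

labels : Tree → List ℕ
labels (leaf l)       = l ∷ []
labels (unary l c)    = l ∷ labels c
labels (binary l c d) = l ∷ labels c ++ labels d

Decreasing : Tree → Set
Decreasing (leaf l)       = ⊤
Decreasing (unary l c)    = (label c < l) × Decreasing c
Decreasing (binary l c d) = (label c < l) × (label d < l) × Decreasing c × Decreasing d

[_] : ℕ → List ℕ
[ n ] = map suc (upTo n)

LPT : ℕ → Tree → Set
LPT n t = (labels t ↭ [ n ]) × Decreasing t

rank : Tree → ℕ
rank (leaf _)       = 0
rank (unary _ c)    = suc (rank c)
rank (binary _ c d) = suc (rank c ⊓ rank d)

isOne : ℕ → ℕ
isOne 1 = 1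
isOne _ = 0

rank1Count : Tree → ℕ
rank1Count t@(leaf _)       = isOne (rank t)
rank1Count t@(unary _ c)    = isOne (rank t) ℕ.+ rank1Count c
rank1Count t@(binary _ c d) = isOne (rank t) ℕ.+ rank1Count c ℕ.+ rank1Count d

record Enumeration (n : ℕ) : Set where
  field
    trees    : List Tree
    unique   : Unique trees
    complete : ∀ t → (t ∈ trees) ⇔ LPT n t

open Enumeration public

bSeq : ((n : ℕ) → Enumeration n) → ℕ → ℕ
bSeq E zero    = 1
bSeq E (suc n) = length (trees (E (suc n)))

b1Seq : ((n : ℕ) → Enumeration n) → ℕ → ℕ
b1Seq E n = sum (map rank1Count (trees (E n)))

-- Exponential generating functions as sequences of EGF coefficients:
-- F(z) = Σ f n z^n / n!  is represented by  f : ℕ → ℤ.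

EGF : Set
EGF = ℕ → ℤ

fromℕseq : (ℕ → ℕ) → EGF
fromℕseq f n = + f n

infixl 6 _⊕_ _⊖_
infixl 7 _⊛_ _·_

_⊕_ : EGF → EGF → EGF
(f ⊕ g) n = f n ℤ.+ g n

_⊖_ : EGF → EGF → EGF
(f ⊖ g) n = f n ℤ.- g n

_·_ : ℤ → EGF → EGF
(c · f) n = c ℤ.* f n

sumℤ : List ℤ → ℤ
sumℤ []       = + 0
sumℤ (x ∷ xs) = x ℤ.+ sumℤ xs

_⊛_ : EGF → EGF → EGF
(f ⊛ g) n = sumℤ (map (λ k → + (n C k) ℤ.* f k ℤ.* g (n ℕ.∸ k)) (upTo (suc n)))

-- derivative d/dz
D : EGF → EGF
D f n = f (suc n)

-- polynomial given by its ordinary coefficient list [a0, a1, a2, ...]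
coeff : List ℤ → ℕ → ℤ
coeff []       _       = + 0
coeff (a ∷ _)  zero    = a
coeff (_ ∷ as) (suc n) = coeff as n

poly : List ℤ → EGF
poly as n = + (n !) ℤ.* coeff as n

const : ℤ → EGF
const c = poly (c ∷ [])

Z : EGF
Z = poly (+ 0 ∷ + 1 ∷ [])

-- √3 · sin(√3 z) = Σ_k (-1)^k 3^(k+1) z^(2k+1)/(2k+1)!
sqrt3Sin : EGF
sqrt3Sin zero          = + 0
sqrt3Sin (suc zero)    = + 3
sqrt3Sin (suc (suc n)) = - (+ 3) ℤ.* sqrt3Sin n

-- cos(√3 z) = Σ_k (-1)^k 3^k z^(2k)/(2k)!
cosSqrt3 : EGF
cosSqrt3 zero          = + 1
cosSqrt3 (suc zero)    = + 0
cosSqrt3 (suc (suc n)) = - (+ 3) ℤ.* cosSqrt3 n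

module Submission where

-- TreeSums, Recurrences: splitting a tree at its root (leaf, unary node,
--   or binary node with the remaining labels split in all ways) turns sums
--   of label-blind statistics into binomial convolutions.  This gives
--   A' = 1 + A + A² for A = B - 1, and B₁' + z² = z + B₁ + 2zA + 2AB₁,
--   because a root has rank 1 exactly when some child is a leaf.
-- Solution: with g = √3 sin √3z - cos √3z - 2, the Riccati equation forces
--   (1 + A + A²) g = -3 and g' = -(1 + 2A) g (a homogeneous linear system
--   with zero initial data); then H = 9 g B₁ - N has H' = 9 (B₁ + z)(g' +
--   (1 + 2A) g) = 0 and H(0) = 0, which is the closed form N / 9g.

open import Defs
open import Data.Nat using (ℕ)
open import Data.Integer using (+_; -_)
open import Data.List using ([]; _∷_)
open import Data.Product using (_×_; _,_)
open import Relation.Binary.PropositionalEquality using (_≡_)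

module EGFRing where
  open import Level using (0ℓ)
  open import Data.Nat as ℕ using (ℕ; zero; suc; _∸_)
  import Data.Nat.Properties as ℕP
  open import Data.Nat.Combinatorics using (_C_; k>n⇒nCk≡0; nCk+nC[k+1]≡[n+1]C[k+1])
  open import Data.Integer as ℤ using (ℤ; +_; -_; _+_; _*_)
  import Data.Integer.Properties as ℤP
  open import Data.Integer.Tactic.RingSolver using (solve-∀)
  open import Data.List using ([]; _∷_; _++_; map; upTo)
  import Data.List.Properties as LP
  open import Data.Product using (_,_)
  open import Data.Maybe using (Maybe; just; nothing)
  open import Relation.Nullary using (yes; no)
  open import Algebra.Bundles using (CommutativeRing)
  open import Algebra.Structures using (IsCommutativeRing)
  import Algebra.Solver.Ring.AlmostCommutativeRing as ACR
  open import Relation.Binary.PropositionalEquality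
  open ≡-Reasoning

  Σ< : (ℕ → ℤ) → ℕ → ℤ
  Σ< F zero    = + 0
  Σ< F (suc n) = Σ< F n + F n

  sumℤ-++ : ∀ xs ys → sumℤ (xs ++ ys) ≡ sumℤ xs + sumℤ ys
  sumℤ-++ []       ys = sym (ℤP.+-identityˡ _)
  sumℤ-++ (x ∷ xs) ys = trans (cong (_+_ (x)) (sumℤ-++ xs ys)) (sym (ℤP.+-assoc x _ _))

  sumℤ-upTo : ∀ F n → sumℤ (map F (upTo n)) ≡ Σ< F n
  sumℤ-upTo F zero    = refl
  sumℤ-upTo F (suc n) = begin
    sumℤ (map F (upTo (suc n)))         ≡⟨ cong (λ l → sumℤ (map F l)) (sym (LP.upTo-∷ʳ n)) ⟩
    sumℤ (map F (upTo n ++ n ∷ []))     ≡⟨ cong sumℤ (LP.map-++ F (upTo n) (n ∷ [])) ⟩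
    sumℤ (map F (upTo n) ++ F n ∷ [])   ≡⟨ sumℤ-++ (map F (upTo n)) (F n ∷ []) ⟩
    sumℤ (map F (upTo n)) + (F n + + 0) ≡⟨ cong₂ _+_ (sumℤ-upTo F n) (ℤP.+-identityʳ _) ⟩
    Σ< F n + F n                        ∎

  Σ<-cong : ∀ {F G} n → (∀ k → k ℕ.< n → F k ≡ G k) → Σ< F n ≡ Σ< G n
  Σ<-cong zero    eq = refl
  Σ<-cong (suc n) eq = cong₂ _+_ (Σ<-cong n (λ k k<n → eq k (ℕP.m<n⇒m<1+n k<n))) (eq n ℕP.≤-refl)

  Σ<-zero : ∀ {F} n → (∀ k → k ℕ.< n → F k ≡ + 0) → Σ< F n ≡ + 0
  Σ<-zero zero    eq = refl
  Σ<-zero (suc n) eq = cong₂ _+_ (Σ<-zero n (λ k k<n → eq k (ℕP.m<n⇒m<1+n k<n))) (eq n ℕP.≤-refl)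

  Σ<-+ : ∀ F G n → Σ< (λ k → F k + G k) n ≡ Σ< F n + Σ< G n
  Σ<-+ F G zero    = refl
  Σ<-+ F G (suc n) = trans (cong (_+ (F n + G n)) (Σ<-+ F G n)) (interchange (Σ< F n) (Σ< G n) (F n) (G n))
    where
    interchange : ∀ a b c d → (a + b) + (c + d) ≡ (a + c) + (b + d)
    interchange = solve-∀

  Σ<-front : ∀ F n → Σ< F (suc n) ≡ F 0 + Σ< (λ k → F (suc k)) n
  Σ<-front F zero    = trans (ℤP.+-identityˡ (F 0)) (sym (ℤP.+-identityʳ (F 0)))
  Σ<-front F (suc n) = trans (cong (_+ F (suc n)) (Σ<-front F n)) (ℤP.+-assoc (F 0) _ _)

  Σ<-only-first : ∀ F n → (∀ k → F (suc k) ≡ + 0) → Σ< F (suc n) ≡ F 0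
  Σ<-only-first F n eq = begin
    Σ< F (suc n)                    ≡⟨ Σ<-front F n ⟩
    F 0 + Σ< (λ k → F (suc k)) n    ≡⟨ cong (_+_ (F 0)) (Σ<-zero n (λ k _ → eq k)) ⟩
    F 0 + + 0                       ≡⟨ ℤP.+-identityʳ (F 0) ⟩
    F 0                             ∎

  conv : (ℕ → ℕ → ℤ) → ℕ → ℤ
  conv F n = Σ< (λ k → + (n C k) * F k (n ∸ k)) (suc n)

  conv-cong : ∀ {F G} n → (∀ i j → F i j ≡ G i j) → conv F n ≡ conv G n
  conv-cong n eq = Σ<-cong (suc n) (λ k _ → cong (+ (n C k) *_) (eq k (n ∸ k)))

  conv-+ : ∀ F G n → conv (λ i j → F i j + G i j) n ≡ conv F n + conv G n
  conv-+ F G n = trans (Σ<-cong (suc n) (λ k _ → ℤP.*-distribˡ-+ (+ (n C k)) (F k (n ∸ k)) (G k (n ∸ k))))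
                       (Σ<-+ (λ k → + (n C k) * F k (n ∸ k)) (λ k → + (n C k) * G k (n ∸ k)) (suc n))

  -- Pascal's rule turns one row of the convolution into the two rows below it:
  -- conv F (n + 1) = conv (F shifted in i) n + conv (F shifted in j) n.
  conv-suc : ∀ F n → conv F (suc n) ≡ conv (λ i j → F (suc i) j) n + conv (λ i j → F i (suc j)) n
  conv-suc F n = begin
    conv F (suc n)                               ≡⟨ Σ<-front T (suc n) ⟩
    T 0 + Σ< (λ j → T (suc j)) (suc n)           ≡⟨ cong (_+_ (T 0)) (trans (Σ<-cong (suc n) (λ j _ → pascal j))
                                                                        (Σ<-+ L R (suc n))) ⟩
    T 0 + (Σ< L (suc n) + Σ< R (suc n))          ≡⟨ exchange (T 0) (Σ< L (suc n)) (Σ< R (suc n)) ⟩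
    Σ< L (suc n) + (T 0 + Σ< R (suc n))          ≡⟨ cong (_+_ (Σ< L (suc n))) right-row ⟩
    Σ< L (suc n) + conv (λ i j → F i (suc j)) n  ∎
    where
    T L R : ℕ → ℤ
    T k = + (suc n C k) * F k (suc n ∸ k)
    L j = + (n C j) * F (suc j) (n ∸ j)
    R j = + (n C suc j) * F (suc j) (n ∸ j)
    pascal : ∀ j → T (suc j) ≡ L j + R j
    pascal j = begin
      + (suc n C suc j) * F (suc j) (n ∸ j)
        ≡⟨ cong (λ c → + c * F (suc j) (n ∸ j)) (sym (nCk+nC[k+1]≡[n+1]C[k+1] n j)) ⟩
      + (n C j ℕ.+ n C suc j) * F (suc j) (n ∸ j)
        ≡⟨ cong (_* F (suc j) (n ∸ j)) (ℤP.pos-+ (n C j) (n C suc j)) ⟩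
      (+ (n C j) + + (n C suc j)) * F (suc j) (n ∸ j)
        ≡⟨ ℤP.*-distribʳ-+ (F (suc j) (n ∸ j)) (+ (n C j)) (+ (n C suc j)) ⟩
      L j + R j ∎
    exchange : ∀ a b c → a + (b + c) ≡ b + (a + c)
    exchange = solve-∀
    -- the term R n carries the coefficient (n choose n + 1) = 0
    right-row : T 0 + Σ< R (suc n) ≡ conv (λ i j → F i (suc j)) n
    right-row = begin
      T 0 + (Σ< R n + R n)   ≡⟨ cong (λ x → T 0 + (Σ< R n + x)) Rn≡0 ⟩
      T 0 + (Σ< R n + + 0)   ≡⟨ cong (_+_ (T 0)) (ℤP.+-identityʳ (Σ< R n)) ⟩
      T 0 + Σ< R n           ≡⟨ cong (λ x → T 0 + x) (Σ<-cong n reindex) ⟩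
      T 0 + Σ< (λ k → + (n C suc k) * F (suc k) (suc (n ∸ suc k))) n
                             ≡⟨ sym (Σ<-front (λ k → + (n C k) * F k (suc (n ∸ k))) n) ⟩
      conv (λ i j → F i (suc j)) n ∎
      where
      Rn≡0 : R n ≡ + 0
      Rn≡0 = trans (cong (λ c → + c * F (suc n) (n ∸ n)) (k>n⇒nCk≡0 (ℕP.n<1+n n)))
                   (ℤP.*-zeroˡ (F (suc n) (n ∸ n)))
      reindex : ∀ k → k ℕ.< n → R k ≡ + (n C suc k) * F (suc k) (suc (n ∸ suc k))
      reindex k k<n = cong (λ m → + (n C suc k) * F (suc k) m) (ℕP.+-∸-assoc 1 k<n)

  ⊛-conv : ∀ f g n → (f ⊛ g) n ≡ conv (λ i j → f i * g j) n
  ⊛-conv f g n = trans (sumℤ-upTo _ (suc n))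
                       (Σ<-cong (suc n) (λ k _ → ℤP.*-assoc (+ (n C k)) (f k) (g (n ∸ k))))

  leibniz : ∀ f g n → (f ⊛ g) (suc n) ≡ (D f ⊛ g) n + (f ⊛ D g) n
  leibniz f g n = begin
    (f ⊛ g) (suc n)                                         ≡⟨ ⊛-conv f g (suc n) ⟩
    conv (λ i j → f i * g j) (suc n)                        ≡⟨ conv-suc (λ i j → f i * g j) n ⟩
    conv (λ i j → D f i * g j) n + conv (λ i j → f i * D g j) n
                                                            ≡⟨ sym (cong₂ _+_ (⊛-conv (D f) g n) (⊛-conv f (D g) n)) ⟩
    (D f ⊛ g) n + (f ⊛ D g) n                               ∎

  ⊛-at-0 : ∀ f g → (f ⊛ g) 0 ≡ f 0 * g 0
  ⊛-at-0 f g = trans (ℤP.+-identityʳ (+ 1 * f 0 * g 0)) (cong (_* g 0) (ℤP.*-identityˡ (f 0)))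

  infix 4 _≋_
  record _≋_ (f g : EGF) : Set where
    constructor mk≋
    field at : ∀ n → f n ≡ g n
  open _≋_ public

  ≋-refl : ∀ {f} → f ≋ f
  ≋-refl = mk≋ (λ n → refl)

  ≋-sym : ∀ {f g} → f ≋ g → g ≋ f
  ≋-sym (mk≋ p) = mk≋ (λ n → sym (p n))

  ≋-trans : ∀ {f g h} → f ≋ g → g ≋ h → f ≋ h
  ≋-trans (mk≋ p) (mk≋ q) = mk≋ (λ n → trans (p n) (q n))

  emb : ℤ → EGF
  emb c zero    = c
  emb c (suc n) = + 0

  zeroE oneE : EGF
  zeroE _ = + 0
  oneE    = emb (+ 1)

  negE : EGF → EGF
  negE f n = - f n

  ⊛-distribˡ : ∀ f g h n → (f ⊛ (g ⊕ h)) n ≡ (f ⊛ g) n + (f ⊛ h) n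
  ⊛-distribˡ f g h n = begin
    (f ⊛ (g ⊕ h)) n                                   ≡⟨ ⊛-conv f (g ⊕ h) n ⟩
    conv (λ i j → f i * (g j + h j)) n                ≡⟨ conv-cong n (λ i j → ℤP.*-distribˡ-+ (f i) (g j) (h j)) ⟩
    conv (λ i j → f i * g j + f i * h j) n            ≡⟨ conv-+ (λ i j → f i * g j) (λ i j → f i * h j) n ⟩
    conv (λ i j → f i * g j) n + conv (λ i j → f i * h j) n
                                                      ≡⟨ sym (cong₂ _+_ (⊛-conv f g n) (⊛-conv f h n)) ⟩
    (f ⊛ g) n + (f ⊛ h) n                             ∎

  ⊛-cong : ∀ {f f′ g g′} → f ≋ f′ → g ≋ g′ → f ⊛ g ≋ f′ ⊛ g′
  ⊛-cong {f} {f′} {g} {g′} (mk≋ p) (mk≋ q) = mk≋ λ n →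
    trans (⊛-conv f g n) (trans (conv-cong n (λ i j → cong₂ _*_ (p i) (q j))) (sym (⊛-conv f′ g′ n)))

  -- Commutativity and associativity follow from the Leibniz rule by
  -- induction on the coefficient index, with the derivative as the step.
  ⊛-comm : ∀ n f g → (f ⊛ g) n ≡ (g ⊛ f) n
  ⊛-comm zero    f g = trans (⊛-at-0 f g) (trans (ℤP.*-comm (f 0) (g 0)) (sym (⊛-at-0 g f)))
  ⊛-comm (suc n) f g = begin
    (f ⊛ g) (suc n)             ≡⟨ leibniz f g n ⟩
    (D f ⊛ g) n + (f ⊛ D g) n   ≡⟨ cong₂ _+_ (⊛-comm n (D f) g) (⊛-comm n f (D g)) ⟩
    (g ⊛ D f) n + (D g ⊛ f) n   ≡⟨ ℤP.+-comm ((g ⊛ D f) n) ((D g ⊛ f) n) ⟩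
    (D g ⊛ f) n + (g ⊛ D f) n   ≡⟨ sym (leibniz g f n) ⟩
    (g ⊛ f) (suc n)             ∎

  ⊛-distribʳ : ∀ f g h n → ((g ⊕ h) ⊛ f) n ≡ (g ⊛ f) n + (h ⊛ f) n
  ⊛-distribʳ f g h n = trans (⊛-comm n (g ⊕ h) f)
    (trans (⊛-distribˡ f g h n) (cong₂ _+_ (⊛-comm n f g) (⊛-comm n f h)))

  ⊛-assoc : ∀ n f g h → ((f ⊛ g) ⊛ h) n ≡ (f ⊛ (g ⊛ h)) n
  ⊛-assoc zero f g h = begin
    ((f ⊛ g) ⊛ h) 0     ≡⟨ trans (⊛-at-0 (f ⊛ g) h) (cong (_* h 0) (⊛-at-0 f g)) ⟩
    f 0 * g 0 * h 0     ≡⟨ ℤP.*-assoc (f 0) (g 0) (h 0) ⟩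
    f 0 * (g 0 * h 0)   ≡⟨ sym (trans (⊛-at-0 f (g ⊛ h)) (cong (f 0 *_) (⊛-at-0 g h))) ⟩
    (f ⊛ (g ⊛ h)) 0     ∎
  ⊛-assoc (suc n) f g h = begin
    ((f ⊛ g) ⊛ h) (suc n)
      ≡⟨ leibniz (f ⊛ g) h n ⟩
    (D (f ⊛ g) ⊛ h) n + ((f ⊛ g) ⊛ D h) n
      ≡⟨ cong (_+ ((f ⊛ g) ⊛ D h) n) (at (⊛-cong {g = h} (mk≋ (leibniz f g)) ≋-refl) n) ⟩
    (((D f ⊛ g) ⊕ (f ⊛ D g)) ⊛ h) n + ((f ⊛ g) ⊛ D h) n
      ≡⟨ cong (_+ ((f ⊛ g) ⊛ D h) n) (⊛-distribʳ h (D f ⊛ g) (f ⊛ D g) n) ⟩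
    ((D f ⊛ g) ⊛ h) n + ((f ⊛ D g) ⊛ h) n + ((f ⊛ g) ⊛ D h) n
      ≡⟨ cong₂ _+_ (cong₂ _+_ (⊛-assoc n (D f) g h) (⊛-assoc n f (D g) h)) (⊛-assoc n f g (D h)) ⟩
    (D f ⊛ (g ⊛ h)) n + (f ⊛ (D g ⊛ h)) n + (f ⊛ (g ⊛ D h)) n
      ≡⟨ ℤP.+-assoc ((D f ⊛ (g ⊛ h)) n) ((f ⊛ (D g ⊛ h)) n) ((f ⊛ (g ⊛ D h)) n) ⟩
    (D f ⊛ (g ⊛ h)) n + ((f ⊛ (D g ⊛ h)) n + (f ⊛ (g ⊛ D h)) n)
      ≡⟨ cong (_+_ ((D f ⊛ (g ⊛ h)) n)) (sym (⊛-distribˡ f (D g ⊛ h) (g ⊛ D h) n)) ⟩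
    (D f ⊛ (g ⊛ h)) n + (f ⊛ ((D g ⊛ h) ⊕ (g ⊛ D h))) n
      ≡⟨ cong (_+_ ((D f ⊛ (g ⊛ h)) n)) (at (⊛-cong {f = f} ≋-refl (mk≋ (λ m → sym (leibniz g h m)))) n) ⟩
    (D f ⊛ (g ⊛ h)) n + (f ⊛ D (g ⊛ h)) n
      ≡⟨ sym (leibniz f (g ⊛ h) n) ⟩
    (f ⊛ (g ⊛ h)) (suc n) ∎

  emb-⊛ : ∀ c f n → (emb c ⊛ f) n ≡ c * f n
  emb-⊛ c f n = begin
    (emb c ⊛ f) n                        ≡⟨ ⊛-conv (emb c) f n ⟩
    conv (λ i j → emb c i * f j) n       ≡⟨ Σ<-only-first _ n (λ k → trans (cong (+ (n C suc k) *_) (ℤP.*-zeroˡ (f (n ∸ suc k))))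
                                                                           (ℤP.*-zeroʳ (+ (n C suc k)))) ⟩
    + 1 * (c * f n)                      ≡⟨ ℤP.*-identityˡ (c * f n) ⟩
    c * f n                              ∎

  egfIsCommutativeRing : IsCommutativeRing _≋_ _⊕_ _⊛_ negE zeroE oneE
  egfIsCommutativeRing = record
    { isRing = record
      { +-isAbelianGroup = record
        { isGroup = record
          { isMonoid = record
            { isSemigroup = record
              { isMagma = record
                { isEquivalence = record { refl = ≋-refl ; sym = ≋-sym ; trans = ≋-trans }
                ; ∙-cong = λ (mk≋ p) (mk≋ q) → mk≋ (λ n → cong₂ _+_ (p n) (q n)) }
              ; assoc = λ f g h → mk≋ (λ n → ℤP.+-assoc (f n) (g n) (h n)) }
            ; identity = (λ f → mk≋ (λ n → ℤP.+-identityˡ (f n))) , (λ f → mk≋ (λ n → ℤP.+-identityʳ (f n))) }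
          ; inverse = (λ f → mk≋ (λ n → ℤP.+-inverseˡ (f n))) , (λ f → mk≋ (λ n → ℤP.+-inverseʳ (f n)))
          ; ⁻¹-cong = λ (mk≋ p) → mk≋ (λ n → cong -_ (p n)) }
        ; comm = λ f g → mk≋ (λ n → ℤP.+-comm (f n) (g n)) }
      ; *-cong = ⊛-cong
      ; *-assoc = λ f g h → mk≋ (λ n → ⊛-assoc n f g h)
      ; *-identity = (λ f → mk≋ (λ n → trans (emb-⊛ (+ 1) f n) (ℤP.*-identityˡ (f n))))
                   , (λ f → mk≋ (λ n → trans (⊛-comm n f oneE) (trans (emb-⊛ (+ 1) f n) (ℤP.*-identityˡ (f n)))))
      ; distrib = (λ f g h → mk≋ (⊛-distribˡ f g h)) , (λ f g h → mk≋ (⊛-distribʳ f g h)) }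
    ; *-comm = λ f g → mk≋ (λ n → ⊛-comm n f g) }

  egfRing : CommutativeRing 0ℓ 0ℓ
  egfRing = record { isCommutativeRing = egfIsCommutativeRing }

  open CommutativeRing egfRing public
    using () renaming (setoid to egfSetoid; +-cong to ⊕-cong; -‿cong to negE-cong)

  -- emb is a ring homomorphism ℤ → EGF; this lets the ring solver work
  -- with integer coefficients.
  emb-* : ∀ a b → emb (a * b) ≋ emb a ⊛ emb b
  emb-* a b = mk≋ λ n → sym (trans (emb-⊛ a (emb b) n) (lemma n))
    where
    lemma : ∀ n → a * emb b n ≡ emb (a * b) n
    lemma zero    = refl
    lemma (suc n) = ℤP.*-zeroʳ a

  embMorphism : ℤ.+-*-rawRing ACR.-Raw-AlmostCommutative⟶ ACR.fromCommutativeRing egfRing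
  embMorphism = record
    { ⟦_⟧    = emb
    ; +-homo = λ a b → mk≋ λ { zero → refl ; (suc n) → refl }
    ; *-homo = emb-*
    ; -‿homo = λ a → mk≋ λ { zero → refl ; (suc n) → refl }
    ; 0-homo = mk≋ λ { zero → refl ; (suc n) → refl }
    ; 1-homo = mk≋ λ { zero → refl ; (suc n) → refl } }

  emb-≟ : ∀ a b → Maybe (emb a ≋ emb b)
  emb-≟ a b with a ℤ.≟ b
  ... | yes refl = just ≋-refl
  ... | no _     = nothing

  open import Algebra.Solver.Ring ℤ.+-*-rawRing (ACR.fromCommutativeRing egfRing) embMorphism emb-≟ public
    using (solve; _:+_; _:*_; :-_; con; _:=_; Polynomial)

open EGFRing using (_≋_; oneE; at)

module Calculus where
  open EGFRing
  open import Data.Nat using (zero; suc; _∸_; _!; _≤_; z≤n; s≤s)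
  import Data.Nat.Properties as ℕP
  open import Data.Nat.Combinatorics using (_C_)
  open import Data.Integer using (ℤ; +_; -_; _+_; _*_)
  import Data.Integer.Properties as ℤP
  open import Data.Integer.Tactic.RingSolver using (solve-∀)
  open import Data.List using (List; []; _∷_)
  open import Data.Product using (_×_; _,_; proj₁; proj₂)
  open import Data.Sum using (inj₁; inj₂)
  open import Relation.Binary.PropositionalEquality
  open ≡-Reasoning

  -- Differentiation rules, stated so that they compose: each takes the
  -- derivatives of the parts and returns the derivative of the whole.

  D-cong : ∀ {f g} → f ≋ g → D f ≋ D g
  D-cong (mk≋ p) = mk≋ (λ n → p (suc n))

  D-⊛ : ∀ f g {f′ g′} → D f ≋ f′ → D g ≋ g′ → D (f ⊛ g) ≋ (f′ ⊛ g) ⊕ (f ⊛ g′)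
  D-⊛ f g p q = ≋-trans (mk≋ (leibniz f g)) (⊕-cong (⊛-cong p (≋-refl {g})) (⊛-cong (≋-refl {f}) q))

  D-⊕ : ∀ f g {f′ g′} → D f ≋ f′ → D g ≋ g′ → D (f ⊕ g) ≋ f′ ⊕ g′
  D-⊕ f g = ⊕-cong

  D-negE : ∀ f {f′} → D f ≋ f′ → D (negE f) ≋ negE f′
  D-negE f = negE-cong

  D-emb : ∀ c → D (emb c) ≋ emb (+ 0)
  D-emb c = mk≋ λ { zero → refl ; (suc n) → refl }

  ·-as-⊛ : ∀ c f → c · f ≋ emb c ⊛ f
  ·-as-⊛ c f = mk≋ (λ n → sym (emb-⊛ c f n))

  const-as-emb : ∀ c → const c ≋ emb c
  const-as-emb c = mk≋ λ { zero → ℤP.*-identityˡ c ; (suc n) → ℤP.*-zeroʳ (+ (suc n !)) }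

  D-Z : D Z ≋ oneE
  D-Z = mk≋ λ { zero → refl ; (suc n) → ℤP.*-zeroʳ (+ (suc (suc n) !)) }

  Z-⊛ : ∀ f n → (Z ⊛ f) (suc n) ≡ + (suc n) * f n
  Z-⊛ f zero = begin
    (Z ⊛ f) 1                   ≡⟨ leibniz Z f 0 ⟩
    (D Z ⊛ f) 0 + (Z ⊛ D f) 0   ≡⟨ cong₂ _+_ (trans (at (⊛-cong D-Z (≋-refl {f})) 0) (emb-⊛ (+ 1) f 0))
                                             (⊛-at-0 Z (D f)) ⟩
    + 1 * f 0 + + 0 * f 1       ≡⟨ cong (_+_ (+ 1 * f 0)) (ℤP.*-zeroˡ (f 1)) ⟩
    + 1 * f 0 + + 0             ≡⟨ ℤP.+-identityʳ (+ 1 * f 0) ⟩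
    + 1 * f 0                   ∎
  Z-⊛ f (suc n) = begin
    (Z ⊛ f) (suc (suc n))                   ≡⟨ leibniz Z f (suc n) ⟩
    (D Z ⊛ f) (suc n) + (Z ⊛ D f) (suc n)   ≡⟨ cong₂ _+_ (trans (at (⊛-cong D-Z (≋-refl {f})) (suc n)) (emb-⊛ (+ 1) f (suc n)))
                                                         (Z-⊛ (D f) n) ⟩
    + 1 * x + + (suc n) * x                 ≡⟨ sym (ℤP.*-distribʳ-+ x (+ 1) (+ suc n)) ⟩
    + (suc (suc n)) * x                     ∎
    where x = f (suc n)

  -- Horner form a₀ + z (a₁ + z (a₂ + ...)) of a polynomial, built from
  -- ring operations only, and its formal derivative.
  horner : List ℤ → EGF
  horner []       = emb (+ 0)
  horner (a ∷ as) = emb a ⊕ (Z ⊛ horner as)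

  hornerD : List ℤ → EGF
  hornerD []       = emb (+ 0)
  hornerD (a ∷ as) = emb (+ 0) ⊕ ((oneE ⊛ horner as) ⊕ (Z ⊛ hornerD as))

  poly-as-horner : ∀ as → poly as ≋ horner as
  poly-as-horner []       = mk≋ λ { zero → refl ; (suc n) → ℤP.*-zeroʳ (+ (suc n !)) }
  poly-as-horner (a ∷ as) = ≋-trans step (⊕-cong (≋-refl {emb a}) (⊛-cong (≋-refl {Z}) (poly-as-horner as)))
    where
    step : poly (a ∷ as) ≋ emb a ⊕ (Z ⊛ poly as)
    step = mk≋ λ
      { zero    → begin
          + 1 * a                ≡⟨ ℤP.*-identityˡ a ⟩
          a                      ≡⟨ sym (ℤP.+-identityʳ a) ⟩
          a + + 0                ≡⟨ cong (_+_ a) (sym (trans (⊛-at-0 Z (poly as)) (ℤP.*-zeroˡ (poly as 0)))) ⟩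
          a + (Z ⊛ poly as) 0    ∎
      ; (suc n) → begin
          + (suc n !) * coeff as n                 ≡⟨ cong (_* coeff as n) (ℤP.pos-* (suc n) (n !)) ⟩
          + suc n * + (n !) * coeff as n           ≡⟨ ℤP.*-assoc (+ suc n) (+ (n !)) (coeff as n) ⟩
          + suc n * poly as n                      ≡⟨ sym (Z-⊛ (poly as) n) ⟩
          (Z ⊛ poly as) (suc n)                    ≡⟨ sym (ℤP.+-identityˡ _) ⟩
          + 0 + (Z ⊛ poly as) (suc n)              ∎ }

  D-horner : ∀ as → D (horner as) ≋ hornerD as
  D-horner []       = D-emb (+ 0)
  D-horner (a ∷ as) = D-⊕ (emb a) (Z ⊛ horner as) (D-emb a) (D-⊛ Z (horner as) D-Z (D-horner as))

  hornerₚ : ∀ {m} → List ℤ → Polynomial m → Polynomial m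
  hornerₚ []       z = con (+ 0)
  hornerₚ (a ∷ as) z = con a :+ z :* hornerₚ as z

  hornerDₚ : ∀ {m} → List ℤ → Polynomial m → Polynomial m
  hornerDₚ []       z = con (+ 0)
  hornerDₚ (a ∷ as) z = con (+ 0) :+ (con (+ 1) :* hornerₚ as z :+ z :* hornerDₚ as z)

  sqrt3Sin-step : ∀ n → sqrt3Sin (suc n) ≡ + 3 * cosSqrt3 n
  cosSqrt3-step : ∀ n → cosSqrt3 (suc n) ≡ - sqrt3Sin n
  sqrt3Sin-step zero          = refl
  sqrt3Sin-step (suc zero)    = refl
  sqrt3Sin-step (suc (suc n)) = trans (cong (- (+ 3) *_) (sqrt3Sin-step n)) (reorder (cosSqrt3 n))
    where
    reorder : ∀ x → - (+ 3) * (+ 3 * x) ≡ + 3 * (- (+ 3) * x)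
    reorder = solve-∀
  cosSqrt3-step zero          = refl
  cosSqrt3-step (suc zero)    = refl
  cosSqrt3-step (suc (suc n)) = trans (cong (- (+ 3) *_) (cosSqrt3-step n)) (reorder (sqrt3Sin n))
    where
    reorder : ∀ x → - (+ 3) * (- x) ≡ - (- (+ 3) * x)
    reorder = solve-∀

  D-sqrt3Sin : D sqrt3Sin ≋ emb (+ 3) ⊛ cosSqrt3
  D-sqrt3Sin = mk≋ (λ n → trans (sqrt3Sin-step n) (sym (emb-⊛ (+ 3) cosSqrt3 n)))

  D-cosSqrt3 : D cosSqrt3 ≋ negE sqrt3Sin
  D-cosSqrt3 = mk≋ cosSqrt3-step

  ⊛-vanishing : ∀ f g n → (∀ k → k ≤ n → g k ≡ + 0) → (f ⊛ g) n ≡ + 0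
  ⊛-vanishing f g n g≡0 = trans (⊛-conv f g n) (Σ<-zero (suc n) (λ k _ → begin
    + (n C k) * (f k * g (n ∸ k))   ≡⟨ cong (λ y → + (n C k) * (f k * y)) (g≡0 (n ∸ k) (ℕP.m∸n≤m n k)) ⟩
    + (n C k) * (f k * + 0)         ≡⟨ cong (+ (n C k) *_) (ℤP.*-zeroʳ (f k)) ⟩
    + (n C k) * + 0                 ≡⟨ ℤP.*-zeroʳ (+ (n C k)) ⟩
    + 0                             ∎))

  D-zero⇒zero : ∀ h → h 0 ≡ + 0 → D h ≋ emb (+ 0) → h ≋ emb (+ 0)
  D-zero⇒zero h h₀ (mk≋ p) = mk≋ λ { zero → h₀ ; (suc n) → trans (p n) (emb-zero n) }
    where
    emb-zero : ∀ n → emb (+ 0) n ≡ + 0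
    emb-zero zero    = refl
    emb-zero (suc n) = refl

  linear-system-zero : ∀ P K a b c d → P 0 ≡ + 0 → K 0 ≡ + 0 →
    D P ≋ (a ⊛ P) ⊕ (b ⊛ K) → D K ≋ (c ⊛ P) ⊕ (d ⊛ K) →
    ∀ n → P n ≡ + 0 × K n ≡ + 0
  linear-system-zero P K a b c d P₀ K₀ DP DK n = upTo n n ℕP.≤-refl
    where
    upTo : ∀ n k → k ≤ n → P k ≡ + 0 × K k ≡ + 0
    upTo zero    .zero z≤n = P₀ , K₀
    upTo (suc n) k   k≤1+n with ℕP.m≤n⇒m<n∨m≡n k≤1+n
    ... | inj₁ (s≤s k≤n) = upTo n k k≤n
    ... | inj₂ refl      = trans (at DP n) (step a b) , trans (at DK n) (step c d)
      where
      step : ∀ u v → ((u ⊛ P) ⊕ (v ⊛ K)) n ≡ + 0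
      step u v = cong₂ _+_ (⊛-vanishing u P n (λ j j≤n → proj₁ (upTo n j j≤n)))
                           (⊛-vanishing v K n (λ j j≤n → proj₂ (upTo n j j≤n)))

module DecreasingTrees where
  open import Data.Nat using (ℕ; zero; suc; _<_; _>_; _≤_; s≤s)
  import Data.Nat.Properties as ℕP
  open import Data.List using (List; []; _∷_; _++_; map; length; concatMap; cartesianProductWith; upTo; downFrom)
  import Data.List.Properties as LP
  open import Data.List.Membership.Propositional using (_∈_; _∉_; find)
  open import Data.List.Membership.Propositional.Properties
  open import Data.List.Relation.Unary.Any using (here; there)
  import Data.List.Relation.Unary.Any as Any
  open import Data.List.Relation.Unary.All as All using (All; []; _∷_)
  import Data.List.Relation.Unary.All.Properties as AllP
  open import Data.List.Relation.Unary.AllPairs as AllPairs using (AllPairs; []; _∷_)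
  import Data.List.Relation.Unary.AllPairs.Properties as AllPairsP
  open import Data.List.Relation.Unary.Unique.Propositional using (Unique)
  import Data.List.Relation.Unary.Unique.Propositional.Properties as UniqueP
  open import Data.List.Relation.Binary.Disjoint.Propositional using (Disjoint)
  open import Data.List.Relation.Binary.Sublist.Propositional using (_⊆_; []; _∷_; _∷ʳ_; lookup)
  open import Data.List.Relation.Binary.Sublist.Propositional.Properties using (All-resp-⊆; length-mono-≤)
  open import Data.List.Relation.Binary.Permutation.Propositional hiding (refl; trans)
  open import Data.List.Relation.Binary.Permutation.Propositional.Properties
  open import Data.List.Membership.Propositional.Properties.WithK using (unique∧set⇒bag)
  open import Data.List.Relation.Binary.BagAndSetEquality using (∼bag⇒↭)
  open import Data.Product using (_×_; _,_; proj₁; proj₂; ∃)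
  open import Data.Sum using (_⊎_; inj₁; inj₂)
  open import Data.Unit using (tt)
  open import Data.Empty using (⊥-elim)
  open import Relation.Nullary using (¬_)
  open import Function.Bundles using (mk⇔; Equivalence)
  open import Relation.Binary.PropositionalEquality hiding ([_])

  -- Strictly decreasing label lists.  A tree on such a list has the head
  -- of the list as its root label.

  StrictlyDecreasing : List ℕ → Set
  StrictlyDecreasing = AllPairs _>_

  AllPairs-resp-⊆ : ∀ {R : ℕ → ℕ → Set} {xs ys} → xs ⊆ ys → AllPairs R ys → AllPairs R xs
  AllPairs-resp-⊆ []          []         = []
  AllPairs-resp-⊆ (y ∷ʳ xs⊆)  (_ ∷ ys)   = AllPairs-resp-⊆ xs⊆ ys
  AllPairs-resp-⊆ (refl ∷ xs⊆) (y ∷ ys)  = All-resp-⊆ xs⊆ y ∷ AllPairs-resp-⊆ xs⊆ ys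

  Split : Set
  Split = List ℕ × List ℕ

  toLeft toRight : ℕ → Split → Split
  toLeft  y (l , r) = y ∷ l , r
  toRight y (l , r) = l , y ∷ r

  splits : List ℕ → List Split
  splits []       = ([] , []) ∷ []
  splits (y ∷ ys) = map (toLeft y) (splits ys) ++ map (toRight y) (splits ys)

  splits-∷⁻ : ∀ {y ys p} → p ∈ splits (y ∷ ys) →
    (∃ λ q → q ∈ splits ys × p ≡ toLeft y q) ⊎ (∃ λ q → q ∈ splits ys × p ≡ toRight y q)
  splits-∷⁻ {y} {ys} p∈ with ∈-++⁻ (map (toLeft y) (splits ys)) p∈
  ... | inj₁ p∈ˡ = inj₁ (∈-map⁻ (toLeft y) p∈ˡ)
  ... | inj₂ p∈ʳ = inj₂ (∈-map⁻ (toRight y) p∈ʳ)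

  splits-↭ : ∀ ys {l r} → (l , r) ∈ splits ys → l ++ r ↭ ys
  splits-↭ []       (here refl) = ↭-refl
  splits-↭ (y ∷ ys) p∈ with splits-∷⁻ {y} {ys} p∈
  ... | inj₁ (_ , q∈ , refl) = prep y (splits-↭ ys q∈)
  ... | inj₂ ((l , r) , q∈ , refl) = ↭-trans (shift y l r) (prep y (splits-↭ ys q∈))

  splits-⊆ : ∀ ys {l r} → (l , r) ∈ splits ys → l ⊆ ys × r ⊆ ys
  splits-⊆ []       (here refl) = [] , []
  splits-⊆ (y ∷ ys) p∈ with splits-∷⁻ {y} {ys} p∈
  ... | inj₁ (_ , q∈ , refl) = refl ∷ proj₁ (splits-⊆ ys q∈) , y ∷ʳ proj₂ (splits-⊆ ys q∈)
  ... | inj₂ (_ , q∈ , refl) = y ∷ʳ proj₁ (splits-⊆ ys q∈) , refl ∷ proj₂ (splits-⊆ ys q∈)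

  splits-complete : ∀ ys (p q : List ℕ) → p ++ q ↭ ys →
    ∃ λ s → s ∈ splits ys × p ↭ proj₁ s × q ↭ proj₂ s
  splits-complete [] [] [] _ = ([] , []) , here refl , ↭-refl , ↭-refl
  splits-complete [] (x ∷ p) q h with ↭-empty-inv h
  ... | ()
  splits-complete [] [] (x ∷ q) h with ↭-empty-inv h
  ... | ()
  splits-complete (y ∷ ys) p q h with ∈-++⁻ p (∈-resp-↭ (↭-sym h) (here refl))
  ... | inj₁ y∈p with ∈-∃++ y∈p
  ...   | p₁ , p₂ , refl with splits-complete ys (p₁ ++ p₂) q (drop-∷ (begin
            y ∷ (p₁ ++ p₂) ++ q  ≡⟨ cong (y ∷_) (LP.++-assoc p₁ p₂ q) ⟩
            y ∷ p₁ ++ p₂ ++ q    ↭⟨ ↭-sym (shift y p₁ (p₂ ++ q)) ⟩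
            p₁ ++ y ∷ p₂ ++ q    ≡⟨ sym (LP.++-assoc p₁ (y ∷ p₂) q) ⟩
            (p₁ ++ y ∷ p₂) ++ q  ↭⟨ h ⟩
            y ∷ ys               ∎))
    where open PermutationReasoning
  ...     | (l , r) , s∈ , pl , qr =
            (y ∷ l , r) , ∈-++⁺ˡ (∈-map⁺ (toLeft y) s∈) , ↭-trans (shift y p₁ p₂) (prep y pl) , qr
  splits-complete (y ∷ ys) p q h | inj₂ y∈q with ∈-∃++ y∈q
  ...   | q₁ , q₂ , refl with splits-complete ys p (q₁ ++ q₂) (drop-∷ (begin
            y ∷ p ++ q₁ ++ q₂    ≡⟨ cong (y ∷_) (sym (LP.++-assoc p q₁ q₂)) ⟩
            y ∷ (p ++ q₁) ++ q₂  ↭⟨ ↭-sym (shift y (p ++ q₁) q₂) ⟩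
            (p ++ q₁) ++ y ∷ q₂  ≡⟨ LP.++-assoc p q₁ (y ∷ q₂) ⟩
            p ++ q₁ ++ y ∷ q₂    ↭⟨ h ⟩
            y ∷ ys               ∎))
    where open PermutationReasoning
  ...     | (l , r) , s∈ , pl , qr =
            (l , y ∷ r) , ∈-++⁺ʳ (map (toLeft y) (splits ys)) (∈-map⁺ (toRight y) s∈) , pl , ↭-trans (shift y q₁ q₂) (prep y qr)

  splits-distinct : ∀ ys → StrictlyDecreasing ys → AllPairs (λ s t → ¬ (proj₁ s ↭ proj₁ t)) (splits ys)
  splits-distinct []       _         = [] ∷ []
  splits-distinct (y ∷ ys) (y> ∷ ys↓) =
    AllPairsP.++⁺ (AllPairsP.map⁺ (AllPairs.map (λ ¬eq eq → ¬eq (drop-∷ eq)) IH))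
                  (AllPairsP.map⁺ IH)
                  (AllP.map⁺ (All.tabulate (λ _ → AllP.map⁺ (All.tabulate (λ t∈ eq →
                     y∉ys (lookup (proj₁ (splits-⊆ ys t∈)) (∈-resp-↭ eq (here refl))))))))
    where
    IH = splits-distinct ys ys↓
    y∉ys : y ∉ ys
    y∉ys y∈ = ℕP.<-irrefl refl (All.lookup y> y∈)

  -- Generating the decreasing trees on a strictly decreasing label list L
  -- (root = head of L).  The fuel k bounds the size and must be ≥ length L.

  leafOn : ℕ → List ℕ → List Tree
  leafOn x []      = leaf x ∷ []
  leafOn x (_ ∷ _) = []

  decTrees : ℕ → List ℕ → List Tree
  binaryTrees : ℕ → ℕ → List ℕ → List Tree
  joins : ℕ → ℕ → Split → List Tree

  decTrees zero    _        = []
  decTrees (suc k) []       = []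
  decTrees (suc k) (x ∷ ys) = leafOn x ys ++ (map (unary x) (decTrees k ys) ++ binaryTrees k x ys)

  binaryTrees k x ys = concatMap (joins k x) (splits ys)
  joins k x (l , r)  = cartesianProductWith (binary x) (decTrees k l) (decTrees k r)

  data Joined (k x : ℕ) (ys : List ℕ) : Tree → Set where
    joined : ∀ {l r c d} → (l , r) ∈ splits ys → c ∈ decTrees k l → d ∈ decTrees k r →
             Joined k x ys (binary x c d)

  data Shape (k x : ℕ) (ys : List ℕ) : Tree → Set where
    leafShape   : ys ≡ [] → Shape k x ys (leaf x)
    unaryShape  : ∀ {c} → c ∈ decTrees k ys → Shape k x ys (unary x c)
    binaryShape : ∀ {t} → Joined k x ys t → Shape k x ys t

  leafOn⁻ : ∀ {x ys t} → t ∈ leafOn x ys → ys ≡ [] × t ≡ leaf x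
  leafOn⁻ {x} {[]} (here refl) = refl , refl

  binaryTrees⁻ : ∀ k x ys {t} → t ∈ binaryTrees k x ys → Joined k x ys t
  binaryTrees⁻ k x ys t∈ with find (∈-concatMap⁻ (joins k x) {xs = splits ys} t∈)
  ... | (l , r) , s∈ , t∈′ with ∈-cartesianProductWith⁻ (binary x) (decTrees k l) (decTrees k r) t∈′
  ...   | c , d , c∈ , d∈ , refl = joined s∈ c∈ d∈

  decTrees⁻ : ∀ k x ys {t} → t ∈ decTrees (suc k) (x ∷ ys) → Shape k x ys t
  decTrees⁻ k x ys t∈ with ∈-++⁻ (leafOn x ys) t∈
  ... | inj₁ t∈ˡ with leafOn⁻ t∈ˡ
  ...   | ys≡[] , refl = leafShape ys≡[]
  decTrees⁻ k x ys t∈ | inj₂ t∈′ with ∈-++⁻ (map (unary x) (decTrees k ys)) t∈′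
  ... | inj₁ t∈ᵘ with ∈-map⁻ (unary x) t∈ᵘ
  ...   | c , c∈ , refl = unaryShape c∈
  decTrees⁻ k x ys t∈ | inj₂ t∈′ | inj₂ t∈ᵇ = binaryShape (binaryTrees⁻ k x ys t∈ᵇ)

  root∈labels : ∀ t → label t ∈ labels t
  root∈labels (leaf x)       = here refl
  root∈labels (unary x _)    = here refl
  root∈labels (binary x _ _) = here refl

  decTrees-labels : ∀ k L {t} → t ∈ decTrees k L → labels t ↭ L
  decTrees-labels (suc k) (x ∷ ys) t∈ with decTrees⁻ k x ys t∈
  ... | leafShape refl           = ↭-refl
  ... | unaryShape c∈            = prep x (decTrees-labels k ys c∈)
  ... | binaryShape (joined {l} {r} s∈ c∈ d∈) =
          prep x (↭-trans (++⁺ (decTrees-labels k l c∈) (decTrees-labels k r d∈)) (splits-↭ ys s∈))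

  decTrees-decreasing : ∀ k L {t} → StrictlyDecreasing L → t ∈ decTrees k L → Decreasing t
  decTrees-decreasing (suc k) (x ∷ ys) (x> ∷ ys↓) t∈ with decTrees⁻ k x ys t∈
  ... | leafShape _ = tt
  ... | unaryShape {c} c∈ =
          All.lookup x> (∈-resp-↭ (decTrees-labels k ys c∈) (root∈labels c)) , decTrees-decreasing k ys ys↓ c∈
  ... | binaryShape (joined {l} {r} {c} {d} s∈ c∈ d∈) =
          All.lookup x> (lookup l⊆ (∈-resp-↭ (decTrees-labels k l c∈) (root∈labels c))) ,
          All.lookup x> (lookup r⊆ (∈-resp-↭ (decTrees-labels k r d∈) (root∈labels d))) ,
          decTrees-decreasing k l (AllPairs-resp-⊆ l⊆ ys↓) c∈ ,
          decTrees-decreasing k r (AllPairs-resp-⊆ r⊆ ys↓) d∈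
    where
    l⊆ = proj₁ (splits-⊆ ys s∈)
    r⊆ = proj₂ (splits-⊆ ys s∈)

  label-max : ∀ t → Decreasing t → ∀ {z} → z ∈ labels t → z ≤ label t
  label-max (leaf x)       _ (here refl) = ℕP.≤-refl
  label-max (unary x c)    _ (here refl) = ℕP.≤-refl
  label-max (unary x c)    (c< , c↓) (there z∈) = ℕP.<⇒≤ (ℕP.≤-<-trans (label-max c c↓ z∈) c<)
  label-max (binary x c d) _ (here refl) = ℕP.≤-refl
  label-max (binary x c d) (c< , d< , c↓ , d↓) (there z∈) with ∈-++⁻ (labels c) z∈
  ... | inj₁ z∈c = ℕP.<⇒≤ (ℕP.≤-<-trans (label-max c c↓ z∈c) c<)
  ... | inj₂ z∈d = ℕP.<⇒≤ (ℕP.≤-<-trans (label-max d d↓ z∈d) d<)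

  root-is-head : ∀ t x ys → All (_< x) ys → labels t ↭ x ∷ ys → Decreasing t → label t ≡ x
  root-is-head t x ys x> h t↓ with ∈-resp-↭ h (root∈labels t)
  ... | here eq    = eq
  ... | there root∈ = ⊥-elim (ℕP.<-irrefl refl
          (ℕP.<-≤-trans (All.lookup x> root∈) (label-max t t↓ (∈-resp-↭ (↭-sym h) (here refl)))))

  decTrees-complete : ∀ k L t → StrictlyDecreasing L → length L ≤ k → labels t ↭ L → Decreasing t → t ∈ decTrees k L
  decTrees-complete k [] (leaf _) _ _ h _ with ↭-empty-inv h
  ... | ()
  decTrees-complete k [] (unary _ _) _ _ h _ with ↭-empty-inv h
  ... | ()
  decTrees-complete k [] (binary _ _ _) _ _ h _ with ↭-empty-inv h
  ... | ()
  decTrees-complete (suc k) (x ∷ ys) t@(leaf _) (x> ∷ _) _ h t↓ with root-is-head t x ys x> h t↓ | ys | ↭-length h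
  ... | refl | []    | _  = here refl
  ... | refl | _ ∷ _ | ()
  decTrees-complete (suc k) (x ∷ ys) t@(unary _ c) (x> ∷ ys↓) (s≤s len) h t↓@(_ , c↓) with root-is-head t x ys x> h t↓
  ... | refl = ∈-++⁺ʳ (leafOn x ys) (∈-++⁺ˡ (∈-map⁺ (unary x) (decTrees-complete k ys c ys↓ len (drop-∷ h) c↓)))
  decTrees-complete (suc k) (x ∷ ys) t@(binary _ c d) (x> ∷ ys↓) (s≤s len) h t↓@(_ , _ , c↓ , d↓)
    with root-is-head t x ys x> h t↓
  ... | refl with splits-complete ys (labels c) (labels d) (drop-∷ h)
  ...   | (l , r) , s∈ , cl , dr =
          ∈-++⁺ʳ (leafOn x ys) (∈-++⁺ʳ (map (unary x) (decTrees k ys))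
            (∈-concatMap⁺ (joins k x) (Any.map (λ { refl → ∈-cartesianProductWith⁺ (binary x)
               (decTrees-complete k l c (AllPairs-resp-⊆ l⊆ ys↓) (ℕP.≤-trans (length-mono-≤ l⊆) len) cl c↓)
               (decTrees-complete k r d (AllPairs-resp-⊆ r⊆ ys↓) (ℕP.≤-trans (length-mono-≤ r⊆) len) dr d↓) }) s∈)))
    where
    l⊆ = proj₁ (splits-⊆ ys s∈)
    r⊆ = proj₂ (splits-⊆ ys s∈)

  leafOn-unique : ∀ x ys → Unique (leafOn x ys)
  leafOn-unique x []      = [] ∷ []
  leafOn-unique x (_ ∷ _) = []

  -- Splittings with different left parts yield disjoint sets of binary
  -- trees, told apart by the labels of the left subtree.
  joins-disjoint : ∀ k x s t → ¬ (proj₁ s ↭ proj₁ t) → Disjoint (joins k x s) (joins k x t)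
  joins-disjoint k x (l , r) (l′ , r′) ¬eq (u∈ , u∈′)
    with ∈-cartesianProductWith⁻ (binary x) (decTrees k l) (decTrees k r) u∈
       | ∈-cartesianProductWith⁻ (binary x) (decTrees k l′) (decTrees k r′) u∈′
  ... | c , _ , c∈ , _ , refl | _ , _ , c∈′ , _ , refl =
        ¬eq (↭-trans (↭-sym (decTrees-labels k l c∈)) (decTrees-labels k l′ c∈′))

  decTrees-unique : ∀ k L → StrictlyDecreasing L → Unique (decTrees k L)
  decTrees-unique zero    L        _          = []
  decTrees-unique (suc k) []       _          = []
  decTrees-unique (suc k) (x ∷ ys) (x> ∷ ys↓) =
    UniqueP.++⁺ (leafOn-unique x ys)
                (UniqueP.++⁺ (UniqueP.map⁺ (λ { refl → refl }) (decTrees-unique k ys ys↓)) binaries-unique unary∩binary)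
                leaf∩rest
    where
    binaries-unique : Unique (binaryTrees k x ys)
    binaries-unique = UniqueP.concat⁺
      (AllP.map⁺ (All.tabulate (λ {s} s∈ →
        UniqueP.cartesianProductWith⁺ (binary x) (λ { refl → refl , refl })
          (decTrees-unique k (proj₁ s) (AllPairs-resp-⊆ (proj₁ (splits-⊆ ys s∈)) ys↓))
          (decTrees-unique k (proj₂ s) (AllPairs-resp-⊆ (proj₂ (splits-⊆ ys s∈)) ys↓)))))
      (AllPairsP.map⁺ (AllPairs.map (λ {s} {t} → joins-disjoint k x s t) (splits-distinct ys ys↓)))

    unary∩binary : Disjoint (map (unary x) (decTrees k ys)) (binaryTrees k x ys)
    unary∩binary (u∈ , b∈) with ∈-map⁻ (unary x) u∈ | binaryTrees⁻ k x ys b∈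
    ... | _ , _ , refl | ()

    leaf∩rest : Disjoint (leafOn x ys) (map (unary x) (decTrees k ys) ++ binaryTrees k x ys)
    leaf∩rest (l∈ , t∈) with leafOn⁻ l∈
    ... | _ , refl with ∈-++⁻ (map (unary x) (decTrees k ys)) t∈
    ...   | inj₁ u∈ with ∈-map⁻ (unary x) u∈
    ...     | _ , _ , ()
    leaf∩rest (l∈ , t∈) | _ , refl | inj₂ b∈ with binaryTrees⁻ k x ys b∈
    ...     | ()

  down : ℕ → List ℕ
  down n = map suc (downFrom n)

  length-down : ∀ n → length (down n) ≡ n
  length-down n = trans (LP.length-map suc (downFrom n)) (LP.length-downFrom n)

  down-bounded : ∀ n → All (_< suc n) (down n)
  down-bounded zero    = []
  down-bounded (suc n) = ℕP.≤-refl ∷ All.map ℕP.m<n⇒m<1+n (down-bounded n)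

  down-decreasing : ∀ n → StrictlyDecreasing (down n)
  down-decreasing zero    = []
  down-decreasing (suc n) = down-bounded n ∷ down-decreasing n

  down-↭ : ∀ n → down n ↭ [ n ]
  down-↭ n = subst (λ l → map suc l ↭ [ n ]) (LP.reverse-upTo n) (map⁺ suc (↭-reverse (upTo n)))

  enumeration-↭ : ∀ n (En : Enumeration n) k → n ≤ k → trees En ↭ decTrees k (down n)
  enumeration-↭ n En k n≤k = ∼bag⇒↭ (unique∧set⇒bag (unique En) (decTrees-unique k (down n) (down-decreasing n))
    (λ {t} → mk⇔ (λ t∈ → let (t-labels , t↓) = Equivalence.to (complete En t) t∈ in
                    decTrees-complete k (down n) t (down-decreasing n) (subst (_≤ k) (sym (length-down n)) n≤k)
                                      (↭-trans t-labels (↭-sym (down-↭ n))) t↓)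
                 (λ t∈ → Equivalence.from (complete En t)
                    (↭-trans (decTrees-labels k (down n) t∈) (down-↭ n) , decTrees-decreasing k (down n) (down-decreasing n) t∈))))

module TreeSums where
  open EGFRing
  open DecreasingTrees
  open import Data.Nat as ℕ using (ℕ; zero; suc; _⊓_)
  import Data.Nat.Properties as ℕP
  open import Data.Nat.ListAction using (sum)
  open import Data.Integer using (ℤ; +_; _+_; _*_)
  import Data.Integer.Properties as ℤP
  open import Data.Integer.Tactic.RingSolver using (solve-∀)
  open import Data.List using (List; []; _∷_; _++_; map; length; concatMap; cartesianProductWith)
  import Data.List.Properties as LP
  open import Data.List.Membership.Propositional using (_∈_)
  open import Data.List.Relation.Unary.Any using (here; there)
  open import Data.List.Relation.Binary.Permutation.Propositional using (_↭_; prep; swap)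
  import Data.List.Relation.Binary.Permutation.Propositional as Perm
  open import Data.Product using (_,_; proj₁; proj₂)
  open import Relation.Binary.PropositionalEquality hiding ([_])
  open ≡-Reasoning

  Σ[_∈_] : ∀ {X : Set} → (X → ℤ) → List X → ℤ
  Σ[ f ∈ xs ] = sumℤ (map f xs)

  Σ-++ : ∀ {X : Set} (f : X → ℤ) xs ys → Σ[ f ∈ xs ++ ys ] ≡ Σ[ f ∈ xs ] + Σ[ f ∈ ys ]
  Σ-++ f xs ys = trans (cong sumℤ (LP.map-++ f xs ys)) (sumℤ-++ (map f xs) (map f ys))

  Σ-map : ∀ {X Y : Set} (f : Y → ℤ) (g : X → Y) xs → Σ[ f ∈ map g xs ] ≡ Σ[ (λ x → f (g x)) ∈ xs ]
  Σ-map f g xs = cong sumℤ (sym (LP.map-∘ xs))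

  Σ-cong : ∀ {X : Set} {f g : X → ℤ} xs → (∀ x → x ∈ xs → f x ≡ g x) → Σ[ f ∈ xs ] ≡ Σ[ g ∈ xs ]
  Σ-cong []       eq = refl
  Σ-cong (x ∷ xs) eq = cong₂ _+_ (eq x (here refl)) (Σ-cong xs (λ y y∈ → eq y (there y∈)))

  Σ-+ : ∀ {X : Set} (f g : X → ℤ) xs → Σ[ (λ x → f x + g x) ∈ xs ] ≡ Σ[ f ∈ xs ] + Σ[ g ∈ xs ]
  Σ-+ f g []       = refl
  Σ-+ f g (x ∷ xs) = trans (cong (λ y → f x + g x + y) (Σ-+ f g xs)) (interchange (f x) (g x) Σ[ f ∈ xs ] Σ[ g ∈ xs ])
    where
    interchange : ∀ a b c d → a + b + (c + d) ≡ a + c + (b + d)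
    interchange = solve-∀

  Σ-*ˡ : ∀ {X : Set} (c : ℤ) (f : X → ℤ) xs → Σ[ (λ x → c * f x) ∈ xs ] ≡ c * Σ[ f ∈ xs ]
  Σ-*ˡ c f []       = sym (ℤP.*-zeroʳ c)
  Σ-*ˡ c f (x ∷ xs) = trans (cong (λ y → c * f x + y) (Σ-*ˡ c f xs)) (sym (ℤP.*-distribˡ-+ c (f x) Σ[ f ∈ xs ]))

  Σ-product : ∀ {X Y : Set} (u : X → ℤ) (v : Y → ℤ) xs ys →
    Σ[ (λ x → Σ[ (λ y → u x * v y) ∈ ys ]) ∈ xs ] ≡ Σ[ u ∈ xs ] * Σ[ v ∈ ys ]
  Σ-product u v xs ys = begin
    Σ[ (λ x → Σ[ (λ y → u x * v y) ∈ ys ]) ∈ xs ]  ≡⟨ Σ-cong xs (λ x _ → Σ-*ˡ (u x) v ys) ⟩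
    Σ[ (λ x → u x * Σ[ v ∈ ys ]) ∈ xs ]            ≡⟨ Σ-cong xs (λ x _ → ℤP.*-comm (u x) Σ[ v ∈ ys ]) ⟩
    Σ[ (λ x → Σ[ v ∈ ys ] * u x) ∈ xs ]            ≡⟨ Σ-*ˡ Σ[ v ∈ ys ] u xs ⟩
    Σ[ v ∈ ys ] * Σ[ u ∈ xs ]                      ≡⟨ ℤP.*-comm Σ[ v ∈ ys ] Σ[ u ∈ xs ] ⟩
    Σ[ u ∈ xs ] * Σ[ v ∈ ys ]                      ∎

  Σ-↭ : ∀ {X : Set} (f : X → ℤ) {xs ys} → xs ↭ ys → Σ[ f ∈ xs ] ≡ Σ[ f ∈ ys ]
  Σ-↭ f Perm.refl        = refl
  Σ-↭ f (prep x p)       = cong (λ z → f x + z) (Σ-↭ f p)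
  Σ-↭ f {_} {_ ∷ _ ∷ ys} (swap x y p) = trans (cong (λ z → f x + (f y + z)) (Σ-↭ f p)) (exchange (f x) (f y) Σ[ f ∈ ys ])
    where
    exchange : ∀ a b c → a + (b + c) ≡ b + (a + c)
    exchange = solve-∀
  Σ-↭ f (Perm.trans p q) = trans (Σ-↭ f p) (Σ-↭ f q)

  Σ-concatMap : ∀ {X Y : Set} (f : Y → ℤ) (g : X → List Y) xs → Σ[ f ∈ concatMap g xs ] ≡ Σ[ (λ x → Σ[ f ∈ g x ]) ∈ xs ]
  Σ-concatMap f g []       = refl
  Σ-concatMap f g (x ∷ xs) = trans (Σ-++ f (g x) (concatMap g xs)) (cong (λ z → Σ[ f ∈ g x ] + z) (Σ-concatMap f g xs))

  Σ-cartesianProductWith : ∀ {X Y W : Set} (f : W → ℤ) (b : X → Y → W) xs ys →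
    Σ[ f ∈ cartesianProductWith b xs ys ] ≡ Σ[ (λ x → Σ[ (λ y → f (b x y)) ∈ ys ]) ∈ xs ]
  Σ-cartesianProductWith f b []       ys = refl
  Σ-cartesianProductWith f b (x ∷ xs) ys = trans (Σ-++ f (map (b x) ys) (cartesianProductWith b xs ys))
    (cong₂ _+_ (Σ-map f (b x) ys) (Σ-cartesianProductWith f b xs ys))

  length-as-Σ : ∀ {X : Set} (xs : List X) → + length xs ≡ Σ[ (λ _ → + 1) ∈ xs ]
  length-as-Σ []       = refl
  length-as-Σ (x ∷ xs) = trans (ℤP.pos-+ 1 (length xs)) (cong (λ z → + 1 + z) (length-as-Σ xs))

  sum-as-Σ : ∀ {X : Set} (f : X → ℕ) xs → + sum (map f xs) ≡ Σ[ (λ x → + f x) ∈ xs ]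
  sum-as-Σ f []       = refl
  sum-as-Σ f (x ∷ xs) = trans (ℤP.pos-+ (f x) (sum (map f xs))) (cong (λ z → + f x + z) (sum-as-Σ f xs))

  -- Summing a function of the part sizes over all splittings of ys gives
  -- the binomial convolution: there are (|ys| choose i) splittings with |l| = i.
  splits-conv : ∀ (F : ℕ → ℕ → ℤ) ys → Σ[ (λ s → F (length (proj₁ s)) (length (proj₂ s))) ∈ splits ys ] ≡ conv F (length ys)
  splits-conv F [] = base (F 0 0)
    where
    base : ∀ a → a + + 0 ≡ + 0 + + 1 * a
    base = solve-∀
  splits-conv F (y ∷ ys) = begin
    Σ[ G ∈ map (toLeft y) (splits ys) ++ map (toRight y) (splits ys) ]
      ≡⟨ Σ-++ G (map (toLeft y) (splits ys)) (map (toRight y) (splits ys)) ⟩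
    Σ[ G ∈ map (toLeft y) (splits ys) ] + Σ[ G ∈ map (toRight y) (splits ys) ]
      ≡⟨ cong₂ _+_ (trans (Σ-map G (toLeft y) (splits ys)) (splits-conv (λ i j → F (suc i) j) ys))
                   (trans (Σ-map G (toRight y) (splits ys)) (splits-conv (λ i j → F i (suc j)) ys)) ⟩
    conv (λ i j → F (suc i) j) (length ys) + conv (λ i j → F i (suc j)) (length ys)
      ≡⟨ sym (conv-suc F (length ys)) ⟩
    conv F (suc (length ys)) ∎
    where
    G : Split → ℤ
    G s = F (length (proj₁ s)) (length (proj₂ s))

  relabel : (ℕ → ℕ) → Tree → Tree
  relabel h (leaf x)       = leaf (h x)
  relabel h (unary x c)    = unary (h x) (relabel h c)
  relabel h (binary x c d) = binary (h x) (relabel h c) (relabel h d)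

  relabelSplit : (ℕ → ℕ) → Split → Split
  relabelSplit h (l , r) = map h l , map h r

  splits-map : ∀ h ys → splits (map h ys) ≡ map (relabelSplit h) (splits ys)
  splits-map h []       = refl
  splits-map h (y ∷ ys) = begin
    map (toLeft (h y)) S ++ map (toRight (h y)) S
      ≡⟨ cong (λ S′ → map (toLeft (h y)) S′ ++ map (toRight (h y)) S′) (splits-map h ys) ⟩
    map (toLeft (h y)) (map (relabelSplit h) (splits ys)) ++ map (toRight (h y)) (map (relabelSplit h) (splits ys))
      ≡⟨ cong₂ _++_ (trans (sym (LP.map-∘ (splits ys))) (LP.map-∘ (splits ys)))
                    (trans (sym (LP.map-∘ (splits ys))) (LP.map-∘ (splits ys))) ⟩
    map (relabelSplit h) (map (toLeft y) (splits ys)) ++ map (relabelSplit h) (map (toRight y) (splits ys))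
      ≡⟨ sym (LP.map-++ (relabelSplit h) (map (toLeft y) (splits ys)) (map (toRight y) (splits ys))) ⟩
    map (relabelSplit h) (splits (y ∷ ys)) ∎
    where S = splits (map h ys)

  cartesianProduct-relabel : ∀ h x cs ds →
    cartesianProductWith (binary (h x)) (map (relabel h) cs) (map (relabel h) ds)
      ≡ map (relabel h) (cartesianProductWith (binary x) cs ds)
  cartesianProduct-relabel h x []       ds = refl
  cartesianProduct-relabel h x (c ∷ cs) ds =
    trans (cong₂ _++_ (trans (sym (LP.map-∘ ds)) (LP.map-∘ ds)) (cartesianProduct-relabel h x cs ds))
          (sym (LP.map-++ (relabel h) (map (binary x c) ds) (cartesianProductWith (binary x) cs ds)))

  decTrees-relabel : ∀ h k L → decTrees k (map h L) ≡ map (relabel h) (decTrees k L)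
  decTrees-relabel h zero    L        = refl
  decTrees-relabel h (suc k) []       = refl
  decTrees-relabel h (suc k) (x ∷ ys) = begin
    leafOn (h x) (map h ys) ++ (map (unary (h x)) (decTrees k (map h ys)) ++ binaryTrees k (h x) (map h ys))
      ≡⟨ cong₂ _++_ (leafOn-relabel ys) (cong₂ _++_ unary-relabel binary-relabel) ⟩
    map (relabel h) (leafOn x ys) ++ (map (relabel h) (map (unary x) (decTrees k ys)) ++ map (relabel h) (binaryTrees k x ys))
      ≡⟨ cong (map (relabel h) (leafOn x ys) ++_) (sym (LP.map-++ (relabel h) (map (unary x) (decTrees k ys)) _)) ⟩
    map (relabel h) (leafOn x ys) ++ map (relabel h) (map (unary x) (decTrees k ys) ++ binaryTrees k x ys)
      ≡⟨ sym (LP.map-++ (relabel h) (leafOn x ys) _) ⟩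
    map (relabel h) (decTrees (suc k) (x ∷ ys)) ∎
    where
    leafOn-relabel : ∀ ys → leafOn (h x) (map h ys) ≡ map (relabel h) (leafOn x ys)
    leafOn-relabel []      = refl
    leafOn-relabel (_ ∷ _) = refl
    unary-relabel : map (unary (h x)) (decTrees k (map h ys)) ≡ map (relabel h) (map (unary x) (decTrees k ys))
    unary-relabel = trans (cong (map (unary (h x))) (decTrees-relabel h k ys))
                          (trans (sym (LP.map-∘ (decTrees k ys))) (LP.map-∘ (decTrees k ys)))
    binary-relabel : binaryTrees k (h x) (map h ys) ≡ map (relabel h) (binaryTrees k x ys)
    binary-relabel = begin
      concatMap (joins k (h x)) (splits (map h ys))
        ≡⟨ cong (concatMap (joins k (h x))) (splits-map h ys) ⟩
      concatMap (joins k (h x)) (map (relabelSplit h) (splits ys))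
        ≡⟨ LP.concatMap-map (joins k (h x)) (relabelSplit h) (splits ys) ⟩
      concatMap (λ s → joins k (h x) (relabelSplit h s)) (splits ys)
        ≡⟨ LP.concatMap-cong (λ (l , r) → trans (cong₂ (cartesianProductWith (binary (h x))) (decTrees-relabel h k l) (decTrees-relabel h k r))
                                                (cartesianProduct-relabel h x (decTrees k l) (decTrees k r))) (splits ys) ⟩
      concatMap (λ s → map (relabel h) (joins k x s)) (splits ys)
        ≡⟨ sym (LP.map-concatMap (relabel h) (joins k x) (splits ys)) ⟩
      map (relabel h) (binaryTrees k x ys) ∎

  ShapeInvariant : (Tree → ℤ) → Set
  ShapeInvariant f = ∀ h t → f (relabel h t) ≡ f t

  Σ-decTrees-length : ∀ f → ShapeInvariant f → ∀ k L L′ → length L ≡ length L′ →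
    Σ[ f ∈ decTrees k L ] ≡ Σ[ f ∈ decTrees k L′ ]
  Σ-decTrees-length f inv k L L′ eq = begin
    Σ[ f ∈ decTrees k L ]                             ≡⟨ forget L ⟩
    Σ[ f ∈ decTrees k (map zeroLabel L) ]            ≡⟨ cong (λ M → Σ[ f ∈ decTrees k M ]) (zeros eq) ⟩
    Σ[ f ∈ decTrees k (map zeroLabel L′) ]           ≡⟨ sym (forget L′) ⟩
    Σ[ f ∈ decTrees k L′ ]                            ∎
    where
    zeroLabel : ℕ → ℕ
    zeroLabel _ = 0
    zeros : ∀ {L L′} → length L ≡ length L′ → map zeroLabel L ≡ map zeroLabel L′
    zeros {[]}    {[]}     _  = refl
    zeros {_ ∷ L} {_ ∷ L′} eq = cong (0 ∷_) (zeros (ℕP.suc-injective eq))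
    forget : ∀ M → Σ[ f ∈ decTrees k M ] ≡ Σ[ f ∈ decTrees k (map zeroLabel M) ]
    forget M = sym (begin
      Σ[ f ∈ decTrees k (map zeroLabel M) ]             ≡⟨ cong (λ ts → Σ[ f ∈ ts ]) (decTrees-relabel zeroLabel k M) ⟩
      Σ[ f ∈ map (relabel zeroLabel) (decTrees k M) ]   ≡⟨ Σ-map f (relabel zeroLabel) (decTrees k M) ⟩
      Σ[ (λ t → f (relabel zeroLabel t)) ∈ decTrees k M ] ≡⟨ Σ-cong (decTrees k M) (λ t _ → inv zeroLabel t) ⟩
      Σ[ f ∈ decTrees k M ]                              ∎)

  one : Tree → ℤ
  one _ = + 1

  isZero : ℕ → ℕ
  isZero zero    = 1
  isZero (suc _) = 0

  isLeaf : Tree → ℤ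
  isLeaf t = + isZero (rank t)

  rank1 : Tree → ℤ
  rank1 t = + rank1Count t

  rank-relabel : ∀ h t → rank (relabel h t) ≡ rank t
  rank-relabel h (leaf x)       = refl
  rank-relabel h (unary x c)    = cong suc (rank-relabel h c)
  rank-relabel h (binary x c d) = cong₂ (λ a b → suc (a ⊓ b)) (rank-relabel h c) (rank-relabel h d)

  rank1Count-relabel : ∀ h t → rank1Count (relabel h t) ≡ rank1Count t
  rank1Count-relabel h (leaf x)       = refl
  rank1Count-relabel h (unary x c)    =
    cong₂ (λ a b → isOne (suc a) ℕ.+ b) (rank-relabel h c) (rank1Count-relabel h c)
  rank1Count-relabel h (binary x c d) =
    cong₂ ℕ._+_ (cong₂ (λ a b → isOne a ℕ.+ b) (rank-relabel h (binary x c d)) (rank1Count-relabel h c))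
                (rank1Count-relabel h d)

  one-invariant : ShapeInvariant one
  one-invariant h t = refl

  isLeaf-invariant : ShapeInvariant isLeaf
  isLeaf-invariant h t = cong (λ r → + isZero r) (rank-relabel h t)

  rank1-invariant : ShapeInvariant rank1
  rank1-invariant h t = cong +_ (rank1Count-relabel h t)

  -- A unary root has rank 1 exactly when its child is a leaf.
  rank1-unary : ∀ x c → rank1 (unary x c) ≡ isLeaf c + rank1 c
  rank1-unary x c = trans (cong (λ a → + (a ℕ.+ rank1Count c)) (isOne-suc (rank c)))
                          (ℤP.pos-+ (isZero (rank c)) (rank1Count c))
    where
    isOne-suc : ∀ r → isOne (suc r) ≡ isZero r
    isOne-suc zero    = refl
    isOne-suc (suc r) = refl

  -- A binary root has rank 1 exactly when some child is a leaf, which by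
  -- inclusion–exclusion is isLeaf c + isLeaf d - isLeaf c · isLeaf d.
  rank1-binary : ∀ x c d → rank1 (binary x c d) + isLeaf c * isLeaf d
                           ≡ isLeaf c * one d + one c * isLeaf d + rank1 c * one d + one c * rank1 d
  rank1-binary x c d = begin
    + (isOne (suc (rank c ⊓ rank d)) ℕ.+ rank1Count c ℕ.+ rank1Count d) + lc * ld
      ≡⟨ cong (_+ lc * ld) (trans (ℤP.pos-+ (isOne (suc (rank c ⊓ rank d)) ℕ.+ rank1Count c) (rank1Count d))
                                  (cong (_+ rank1 d) (ℤP.pos-+ (isOne (suc (rank c ⊓ rank d))) (rank1Count c)))) ⟩
    + isOne (suc (rank c ⊓ rank d)) + rank1 c + rank1 d + lc * ld
      ≡⟨ reorder (+ isOne (suc (rank c ⊓ rank d))) (rank1 c) (rank1 d) (lc * ld) ⟩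
    (+ isOne (suc (rank c ⊓ rank d)) + lc * ld) + rank1 c + rank1 d
      ≡⟨ cong (λ y → y + rank1 c + rank1 d) (inclusion-exclusion (rank c) (rank d)) ⟩
    lc * + 1 + + 1 * ld + rank1 c + rank1 d
      ≡⟨ units lc ld (rank1 c) (rank1 d) ⟩
    lc * one d + one c * ld + rank1 c * one d + one c * rank1 d ∎
    where
    lc = isLeaf c
    ld = isLeaf d
    inclusion-exclusion : ∀ a b → + isOne (suc (a ⊓ b)) + + isZero a * + isZero b ≡ + isZero a * + 1 + + 1 * + isZero b
    inclusion-exclusion zero    zero    = refl
    inclusion-exclusion zero    (suc b) = refl
    inclusion-exclusion (suc a) zero    = refl
    inclusion-exclusion (suc a) (suc b) = refl
    reorder : ∀ i a b z → i + a + b + z ≡ (i + z) + a + b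
    reorder = solve-∀
    units : ∀ a b c d → a * + 1 + + 1 * b + c + d ≡ a * + 1 + + 1 * b + c * + 1 + + 1 * d
    units = solve-∀

module Recurrences (E : (n : ℕ) → Enumeration n) where
  open EGFRing
  open DecreasingTrees
  open TreeSums
  open Calculus using (D-cong)
  open import Data.Nat using (zero; suc; _≤_; _!; z≤n)
  import Data.Nat.Properties as ℕP
  open import Data.Integer using (ℤ; +_; _+_; _-_; _*_)
  open import Data.Nat.ListAction using (sum)
  import Data.Integer.Properties as ℤP
  open import Data.Integer.Tactic.RingSolver using (solve-∀)
  open import Data.List using (List; []; _∷_; _++_; map; length)
  open import Data.List.Relation.Binary.Sublist.Propositional using (_⊆_)
  open import Data.List.Relation.Binary.Sublist.Propositional.Properties using (length-mono-≤)
  open import Data.List.Membership.Propositional using (_∈_)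
  open import Data.List.Relation.Binary.Permutation.Propositional.Properties using (↭-empty-inv)
  open import Data.Product using (_,_; proj₁; proj₂)
  open import Relation.Binary.PropositionalEquality hiding ([_])
  open ≡-Reasoning

  total : (Tree → ℤ) → EGF
  total f n = Σ[ f ∈ trees (E n) ]

  no-trees-on-∅ : trees (E 0) ≡ []
  no-trees-on-∅ = ↭-empty-inv (enumeration-↭ 0 (E 0) 0 z≤n)

  total-decTrees : ∀ f → ShapeInvariant f → ∀ k L → length L ≤ k →
    Σ[ f ∈ decTrees k L ] ≡ total f (length L)
  total-decTrees f inv k L |L|≤k = begin
    Σ[ f ∈ decTrees k L ]              ≡⟨ Σ-decTrees-length f inv k L (down m) (sym (length-down m)) ⟩
    Σ[ f ∈ decTrees k (down m) ]       ≡⟨ sym (Σ-↭ f (enumeration-↭ m (E m) k |L|≤k)) ⟩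
    total f m                          ∎
    where m = length L

  total-down : ∀ f → ShapeInvariant f → ∀ n → Σ[ f ∈ decTrees n (down n) ] ≡ total f n
  total-down f inv n = trans (total-decTrees f inv n (down n) (ℕP.≤-reflexive (length-down n)))
                             (cong (total f) (length-down n))

  -- Decomposition at the root: a tree on [n + 1] has root n + 1, and is a
  -- leaf, a unary node over a tree on [n], or a binary node over the two
  -- parts of a splitting of [n].

  binarySum : ℕ → (Tree → Tree → ℤ) → ℤ
  binarySum n F = Σ[ (λ s → Σ[ (λ c → Σ[ (λ d → F c d) ∈ decTrees n (proj₂ s) ]) ∈ decTrees n (proj₁ s) ]) ∈ splits (down n) ]

  total-root : ∀ f n → total f (suc n) ≡
    Σ[ f ∈ leafOn (suc n) (down n) ] + (Σ[ (λ c → f (unary (suc n) c)) ∈ decTrees n (down n) ]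
                                        + binarySum n (λ c d → f (binary (suc n) c d)))
  total-root f n = begin
    total f (suc n)
      ≡⟨ Σ-↭ f (enumeration-↭ (suc n) (E (suc n)) (suc n) ℕP.≤-refl) ⟩
    Σ[ f ∈ leafOn x ys ++ (map (unary x) (decTrees n ys) ++ binaryTrees n x ys) ]
      ≡⟨ Σ-++ f (leafOn x ys) _ ⟩
    Σ[ f ∈ leafOn x ys ] + Σ[ f ∈ map (unary x) (decTrees n ys) ++ binaryTrees n x ys ]
      ≡⟨ cong (λ y → Σ[ f ∈ leafOn x ys ] + y) (trans (Σ-++ f (map (unary x) (decTrees n ys)) (binaryTrees n x ys))
           (cong₂ _+_ (Σ-map f (unary x) (decTrees n ys))
                      (trans (Σ-concatMap f (joins n x) (splits ys))
                             (Σ-cong (splits ys) (λ (l , r) _ → Σ-cartesianProductWith f (binary x) (decTrees n l) (decTrees n r)))))) ⟩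
    Σ[ f ∈ leafOn x ys ] + (Σ[ (λ c → f (unary x c)) ∈ decTrees n ys ] + binarySum n (λ c d → f (binary x c d))) ∎
    where
    x  = suc n
    ys = down n

  binarySum-cong : ∀ n {F G} → (∀ c d → F c d ≡ G c d) → binarySum n F ≡ binarySum n G
  binarySum-cong n eq = Σ-cong (splits (down n)) (λ s _ → Σ-cong (decTrees n (proj₁ s)) (λ c _ →
                          Σ-cong (decTrees n (proj₂ s)) (λ d _ → eq c d)))

  binarySum-+ : ∀ n F G → binarySum n (λ c d → F c d + G c d) ≡ binarySum n F + binarySum n G
  binarySum-+ n F G = trans (Σ-cong (splits (down n)) (λ s _ →
      trans (Σ-cong (decTrees n (proj₁ s)) (λ c _ → Σ-+ (F c) (G c) (decTrees n (proj₂ s))))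
            (Σ-+ _ _ (decTrees n (proj₁ s)))))
    (Σ-+ _ _ (splits (down n)))

  -- For a product statistic the binary part is the EGF product: this is
  -- where the binomial convolution comes from.
  binarySum-product : ∀ u v → ShapeInvariant u → ShapeInvariant v → ∀ n →
    binarySum n (λ c d → u c * v d) ≡ (total u ⊛ total v) n
  binarySum-product u v u-inv v-inv n = begin
    binarySum n (λ c d → u c * v d)
      ≡⟨ Σ-cong (splits ys) (λ (l , r) s∈ → trans (Σ-product u v (decTrees n l) (decTrees n r))
            (cong₂ _*_ (part u u-inv l (proj₁ (splits-⊆ ys s∈))) (part v v-inv r (proj₂ (splits-⊆ ys s∈))))) ⟩
    Σ[ (λ s → total u (length (proj₁ s)) * total v (length (proj₂ s))) ∈ splits ys ]
      ≡⟨ splits-conv (λ i j → total u i * total v j) ys ⟩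
    conv (λ i j → total u i * total v j) (length ys)
      ≡⟨ sym (⊛-conv (total u) (total v) (length ys)) ⟩
    (total u ⊛ total v) (length ys)
      ≡⟨ cong (total u ⊛ total v) (length-down n) ⟩
    (total u ⊛ total v) n ∎
    where
    ys = down n
    part : ∀ f → ShapeInvariant f → ∀ l → l ⊆ ys →
           Σ[ f ∈ decTrees n l ] ≡ total f (length l)
    part f inv l l⊆ = total-decTrees f inv n l
                        (ℕP.≤-trans (length-mono-≤ l⊆)
                                    (ℕP.≤-reflexive (length-down n)))

  count-recurrence : ∀ n → total one (suc n) ≡ oneE n + total one n + (total one ⊛ total one) n
  count-recurrence n = begin
    total one (suc n)
      ≡⟨ total-root one n ⟩
    Σ[ one ∈ leafOn (suc n) (down n) ] + (Σ[ one ∈ decTrees n (down n) ] + binarySum n (λ c d → one c * one d))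
      ≡⟨ cong₂ _+_ (single-leaf n) (cong₂ _+_ (total-down one one-invariant n)
                                              (binarySum-product one one one-invariant one-invariant n)) ⟩
    oneE n + (total one n + (total one ⊛ total one) n)
      ≡⟨ sym (ℤP.+-assoc (oneE n) (total one n) _) ⟩
    oneE n + total one n + (total one ⊛ total one) n ∎
    where
    -- only the tree on [1] is a leaf
    single-leaf : ∀ n → Σ[ one ∈ leafOn (suc n) (down n) ] ≡ oneE n
    single-leaf zero    = refl
    single-leaf (suc n) = refl

  -- Only the tree on [1] is a leaf: the total of isLeaf is z.
  total-isLeaf : ∀ m → total isLeaf m ≡ Z m
  total-isLeaf zero          = cong (λ ts → Σ[ isLeaf ∈ ts ]) no-trees-on-∅
  total-isLeaf (suc zero)    = Σ-↭ isLeaf (enumeration-↭ 1 (E 1) 1 ℕP.≤-refl)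
  total-isLeaf (suc (suc j)) = begin
    total isLeaf (suc (suc j))            ≡⟨ Σ-↭ isLeaf (enumeration-↭ m (E m) m ℕP.≤-refl) ⟩
    Σ[ isLeaf ∈ decTrees m (down m) ]     ≡⟨ Σ-cong (decTrees m (down m)) not-leaf ⟩
    Σ[ (λ _ → + 0) ∈ decTrees m (down m) ] ≡⟨ Σ-zero (decTrees m (down m)) ⟩
    + 0                                   ≡⟨ sym (ℤP.*-zeroʳ (+ (m !))) ⟩
    Z m                                   ∎
    where
    m = suc (suc j)
    not-leaf : ∀ t → t ∈ decTrees m (down m) → isLeaf t ≡ + 0
    not-leaf t t∈ with decTrees⁻ (suc j) m (down (suc j)) t∈
    ... | leafShape ()
    ... | unaryShape _  = refl
    ... | binaryShape (joined _ _ _) = refl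
    Σ-zero : ∀ (ts : List Tree) → Σ[ (λ _ → + 0) ∈ ts ] ≡ + 0
    Σ-zero []       = refl
    Σ-zero (_ ∷ ts) = trans (ℤP.+-identityˡ _) (Σ-zero ts)

  rank1-unary-part : ∀ n → Σ[ (λ c → rank1 (unary (suc n) c)) ∈ decTrees n (down n) ] ≡ total isLeaf n + total rank1 n
  rank1-unary-part n = begin
    Σ[ (λ c → rank1 (unary (suc n) c)) ∈ ts ]                 ≡⟨ Σ-cong ts (λ c _ → rank1-unary (suc n) c) ⟩
    Σ[ (λ c → isLeaf c + rank1 c) ∈ ts ]                      ≡⟨ Σ-+ isLeaf rank1 ts ⟩
    Σ[ isLeaf ∈ ts ] + Σ[ rank1 ∈ ts ]                        ≡⟨ cong₂ _+_ (total-down isLeaf isLeaf-invariant n)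
                                                                          (total-down rank1 rank1-invariant n) ⟩
    total isLeaf n + total rank1 n                            ∎
    where ts = decTrees n (down n)

  -- The rank-1 part of binary root trees, corrected by the doubly counted
  -- case where both children are leaves.
  rank1-binary-part : ∀ n → binarySum n (λ c d → rank1 (binary (suc n) c d)) + (total isLeaf ⊛ total isLeaf) n
    ≡ (total isLeaf ⊛ total one) n + (total one ⊛ total isLeaf) n + (total rank1 ⊛ total one) n + (total one ⊛ total rank1) n
  rank1-binary-part n = begin
    binarySum n (λ c d → rank1 (binary (suc n) c d)) + (total isLeaf ⊛ total isLeaf) n
      ≡⟨ cong (λ y → binarySum n (λ c d → rank1 (binary (suc n) c d)) + y)
              (sym (binarySum-product isLeaf isLeaf isLeaf-invariant isLeaf-invariant n)) ⟩
    binarySum n (λ c d → rank1 (binary (suc n) c d)) + binarySum n (λ c d → isLeaf c * isLeaf d)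
      ≡⟨ sym (binarySum-+ n _ _) ⟩
    binarySum n (λ c d → rank1 (binary (suc n) c d) + isLeaf c * isLeaf d)
      ≡⟨ binarySum-cong n (rank1-binary (suc n)) ⟩
    binarySum n (λ c d → isLeaf c * one d + one c * isLeaf d + rank1 c * one d + one c * rank1 d)
      ≡⟨ trans (binarySum-+ n _ _) (cong (_+ binarySum n (λ c d → one c * rank1 d))
           (trans (binarySum-+ n _ _) (cong (_+ binarySum n (λ c d → rank1 c * one d)) (binarySum-+ n _ _)))) ⟩
    binarySum n (λ c d → isLeaf c * one d) + binarySum n (λ c d → one c * isLeaf d)
      + binarySum n (λ c d → rank1 c * one d) + binarySum n (λ c d → one c * rank1 d)
      ≡⟨ cong₂ _+_ (cong₂ _+_ (cong₂ _+_ (product isLeaf one isLeaf-invariant one-invariant)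
                                         (product one isLeaf one-invariant isLeaf-invariant))
                              (product rank1 one rank1-invariant one-invariant))
                   (product one rank1 one-invariant rank1-invariant) ⟩
    (total isLeaf ⊛ total one) n + (total one ⊛ total isLeaf) n + (total rank1 ⊛ total one) n + (total one ⊛ total rank1) n ∎
    where
    product : ∀ u v → ShapeInvariant u → ShapeInvariant v → binarySum n (λ c d → u c * v d) ≡ (total u ⊛ total v) n
    product u v u-inv v-inv = binarySum-product u v u-inv v-inv n

  -- B₁' + z² = z + B₁ + z (B - 1) + (B - 1) z + B₁ (B - 1) + (B - 1) B₁, coefficientwise
  -- (with the statistics isLeaf, one, rank1 standing for z, B - 1, B₁).
  rank1-recurrence : ∀ n → total rank1 (suc n) + (total isLeaf ⊛ total isLeaf) n
    ≡ total isLeaf n + total rank1 n + (total isLeaf ⊛ total one) n + (total one ⊛ total isLeaf) n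
      + (total rank1 ⊛ total one) n + (total one ⊛ total rank1) n
  rank1-recurrence n = begin
    total rank1 (suc n) + II n
      ≡⟨ cong (_+ II n) (total-root rank1 n) ⟩
    Σ[ rank1 ∈ leafOn (suc n) (down n) ] + (U + Bn) + II n
      ≡⟨ cong (λ y → y + (U + Bn) + II n) (no-rank1-leaf (down n)) ⟩
    + 0 + (U + Bn) + II n
      ≡⟨ reassociate U Bn (II n) ⟩
    U + (Bn + II n)
      ≡⟨ cong₂ _+_ (rank1-unary-part n) (rank1-binary-part n) ⟩
    total isLeaf n + total rank1 n + ((total isLeaf ⊛ total one) n + (total one ⊛ total isLeaf) n
      + (total rank1 ⊛ total one) n + (total one ⊛ total rank1) n)
      ≡⟨ flatten (total isLeaf n) (total rank1 n) _ _ _ _ ⟩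
    total isLeaf n + total rank1 n + (total isLeaf ⊛ total one) n + (total one ⊛ total isLeaf) n
      + (total rank1 ⊛ total one) n + (total one ⊛ total rank1) n ∎
    where
    II = total isLeaf ⊛ total isLeaf
    U  = Σ[ (λ c → rank1 (unary (suc n) c)) ∈ decTrees n (down n) ]
    Bn = binarySum n (λ c d → rank1 (binary (suc n) c d))
    no-rank1-leaf : ∀ ys → Σ[ rank1 ∈ leafOn (suc n) ys ] ≡ + 0
    no-rank1-leaf []      = refl
    no-rank1-leaf (_ ∷ _) = refl
    reassociate : ∀ a b c → + 0 + (a + b) + c ≡ a + (b + c)
    reassociate = solve-∀
    flatten : ∀ a b c d e f → a + b + (c + d + e + f) ≡ a + b + c + d + e + f
    flatten = solve-∀

  A : EGF
  A = total one

  B-1≋A : fromℕseq (bSeq E) ⊖ const (+ 1) ≋ A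
  B-1≋A = mk≋ λ
    { zero    → cong (λ ts → Σ[ one ∈ ts ]) (sym no-trees-on-∅)
    ; (suc n) → begin
        + length (trees (E (suc n))) - + (suc n !) * + 0   ≡⟨ cong (λ y → + length (trees (E (suc n))) - y) (ℤP.*-zeroʳ (+ (suc n !))) ⟩
        + length (trees (E (suc n))) - + 0                  ≡⟨ ℤP.+-identityʳ _ ⟩
        + length (trees (E (suc n)))                        ≡⟨ length-as-Σ (trees (E (suc n))) ⟩
        A (suc n)                                           ∎ }

  B₁≋total : fromℕseq (b1Seq E) ≋ total rank1
  B₁≋total = mk≋ (λ m → sum-as-Σ rank1Count (trees (E m)))

  -- Both A and B₁ start at 0, as there is no tree on the empty set.
  A-at-0 : A 0 ≡ + 0
  A-at-0 = cong (λ ts → Σ[ one ∈ ts ]) no-trees-on-∅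

  B₁-at-0 : fromℕseq (b1Seq E) 0 ≡ + 0
  B₁-at-0 = cong (λ ts → + sum (map rank1Count ts)) no-trees-on-∅

  count-ode : D A ≋ oneE ⊕ A ⊕ (A ⊛ A)
  count-ode = mk≋ count-recurrence

  rank1-ode : ∀ R → R ≋ total rank1 → (D R ⊕ (Z ⊛ Z)) ≋ (Z ⊕ R ⊕ (Z ⊛ A) ⊕ (A ⊛ Z) ⊕ (R ⊛ A) ⊕ (A ⊛ R))
  rank1-ode R R≋T = ≋-trans (⊕-cong (D-cong R≋T) (⊛-cong Z≋L Z≋L))
                   (≋-trans (mk≋ rank1-recurrence) (≋-sym rename))
    where
    Z≋L : Z ≋ total isLeaf
    Z≋L = mk≋ (λ m → sym (total-isLeaf m))
    rename : (Z ⊕ R ⊕ (Z ⊛ A) ⊕ (A ⊛ Z) ⊕ (R ⊛ A) ⊕ (A ⊛ R))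
           ≋ (total isLeaf ⊕ total rank1 ⊕ (total isLeaf ⊛ A) ⊕ (A ⊛ total isLeaf) ⊕ (total rank1 ⊛ A) ⊕ (A ⊛ total rank1))
    rename = ⊕-cong (⊕-cong (⊕-cong (⊕-cong (⊕-cong Z≋L R≋T) (⊛-cong Z≋L (≋-refl {A}))) (⊛-cong (≋-refl {A}) Z≋L))
                            (⊛-cong R≋T (≋-refl {A})))
                    (⊛-cong (≋-refl {A}) R≋T)

module Solution
  (A B₁ : EGF) (A₀ : A 0 ≡ + 0) (B₁₀ : B₁ 0 ≡ + 0)
  (riccati : D A ≋ oneE ⊕ A ⊕ (A ⊛ A))
  (rank1-ode : (D B₁ ⊕ (Z ⊛ Z)) ≋ (Z ⊕ B₁ ⊕ (Z ⊛ A) ⊕ (A ⊛ Z) ⊕ (B₁ ⊛ A) ⊕ (A ⊛ B₁)))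
  where
  open EGFRing
  open Calculus
  open import Data.Nat using (zero; suc)
  open import Data.Integer using (ℤ; -_; _+_; _*_)
  open import Data.List using (List; []; _∷_)
  open import Data.Product using (_×_; proj₂)
  open import Relation.Binary.PropositionalEquality using (cong; cong₂; trans)
  open import Relation.Binary.Reasoning.Setoid egfSetoid

  -- g = √3 sin √3z - cos √3z - 2, so that 9 g is the denominator of the
  -- closed form, and its derivative g′.
  g g′ : EGF
  g  = sqrt3Sin ⊕ negE cosSqrt3 ⊕ negE (emb (+ 2))
  g′ = (emb (+ 3) ⊛ cosSqrt3) ⊕ sqrt3Sin

  D-g : D g ≋ g′
  D-g = begin
    D g
      ≈⟨ D-⊕ (sqrt3Sin ⊕ negE cosSqrt3) (negE (emb (+ 2)))
             (D-⊕ sqrt3Sin (negE cosSqrt3) D-sqrt3Sin (D-negE cosSqrt3 D-cosSqrt3)) (D-negE (emb (+ 2)) (D-emb (+ 2))) ⟩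
    (emb (+ 3) ⊛ cosSqrt3) ⊕ negE (negE sqrt3Sin) ⊕ negE (emb (+ 0))
      ≈⟨ solve 2 (λ c s → con (+ 3) :* c :+ :- (:- s) :+ :- con (+ 0) := con (+ 3) :* c :+ s) ≋-refl cosSqrt3 sqrt3Sin ⟩
    g′ ∎

  -- The Riccati equation A′ = 1 + A + A² forces the two identities
  --   (1 + A + A²) g = -3   and   g′ = -(1 + 2A) g,
  -- i.e. the vanishing of P and K below: they satisfy a homogeneous
  -- linear system with zero initial values.

  Q W P K : EGF
  Q = oneE ⊕ A ⊕ (A ⊛ A)
  W = oneE ⊕ (emb (+ 2) ⊛ A)
  P = (Q ⊛ g) ⊕ emb (+ 3)
  K = (W ⊛ g) ⊕ g′

  D-Q : D Q ≋ (emb (+ 0) ⊕ Q ⊕ ((Q ⊛ A) ⊕ (A ⊛ Q)))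
  D-Q = D-⊕ (oneE ⊕ A) (A ⊛ A) (D-⊕ oneE A (D-emb (+ 1)) riccati) (D-⊛ A A riccati riccati)

  D-P : D P ≋ (emb (+ 0) ⊛ P) ⊕ (Q ⊛ K)
  D-P = begin
    D P
      ≈⟨ D-⊕ (Q ⊛ g) (emb (+ 3)) (D-⊛ Q g D-Q D-g) (D-emb (+ 3)) ⟩
    ((emb (+ 0) ⊕ Q ⊕ ((Q ⊛ A) ⊕ (A ⊛ Q))) ⊛ g ⊕ Q ⊛ g′) ⊕ emb (+ 0)
      ≈⟨ solve 3 (λ a s c →
           let q  = con (+ 1) :+ a :+ a :* a
               gₚ = s :+ :- c :+ :- con (+ 2)
               g′ₚ = con (+ 3) :* c :+ s
               w  = con (+ 1) :+ con (+ 2) :* a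
           in ((con (+ 0) :+ q :+ (q :* a :+ a :* q)) :* gₚ :+ q :* g′ₚ) :+ con (+ 0)
              := con (+ 0) :* (q :* gₚ :+ con (+ 3)) :+ q :* (w :* gₚ :+ g′ₚ))
         ≋-refl A sqrt3Sin cosSqrt3 ⟩
    (emb (+ 0) ⊛ P) ⊕ (Q ⊛ K) ∎

  D-K : D K ≋ (emb (- (+ 2)) ⊛ P) ⊕ (W ⊛ K)
  D-K = begin
    D K
      ≈⟨ D-⊕ (W ⊛ g) g′
           (D-⊛ W g (D-⊕ oneE (emb (+ 2) ⊛ A) (D-emb (+ 1)) (D-⊛ (emb (+ 2)) A (D-emb (+ 2)) riccati)) D-g)
           (D-⊕ (emb (+ 3) ⊛ cosSqrt3) sqrt3Sin (D-⊛ (emb (+ 3)) cosSqrt3 (D-emb (+ 3)) D-cosSqrt3) D-sqrt3Sin) ⟩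
    ((emb (+ 0) ⊕ ((emb (+ 0) ⊛ A) ⊕ (emb (+ 2) ⊛ Q))) ⊛ g ⊕ W ⊛ g′)
      ⊕ ((emb (+ 0) ⊛ cosSqrt3 ⊕ emb (+ 3) ⊛ negE sqrt3Sin) ⊕ (emb (+ 3) ⊛ cosSqrt3))
      ≈⟨ solve 3 (λ a s c →
           let q  = con (+ 1) :+ a :+ a :* a
               gₚ = s :+ :- c :+ :- con (+ 2)
               g′ₚ = con (+ 3) :* c :+ s
               w  = con (+ 1) :+ con (+ 2) :* a
           in ((con (+ 0) :+ (con (+ 0) :* a :+ con (+ 2) :* q)) :* gₚ :+ w :* g′ₚ)
                :+ ((con (+ 0) :* c :+ con (+ 3) :* (:- s)) :+ con (+ 3) :* c)
              := con (- (+ 2)) :* (q :* gₚ :+ con (+ 3)) :+ w :* (w :* gₚ :+ g′ₚ))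
         ≋-refl A sqrt3Sin cosSqrt3 ⟩
    (emb (- (+ 2)) ⊛ P) ⊕ (W ⊛ K) ∎

  K≋0 : K ≋ emb (+ 0)
  K≋0 = mk≋ λ { zero → proj₂ (PK≡0 0) ; (suc n) → proj₂ (PK≡0 (suc n)) }
    where
    Q₀ : Q 0 ≡ + 1
    Q₀ = cong₂ (λ x y → (+ 1 + x) + y) A₀ (trans (⊛-at-0 A A) (cong₂ _*_ A₀ A₀))
    P₀ : P 0 ≡ + 0
    P₀ = cong (_+ + 3) (trans (⊛-at-0 Q g) (cong (_* g 0) Q₀))
    K₀ : K 0 ≡ + 0
    K₀ = cong (_+ g′ 0) (trans (⊛-at-0 W g) (cong (λ y → (+ 1 + y) * g 0) (trans (emb-⊛ (+ 2) A 0) (cong (+ 2 *_) A₀))))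
    PK≡0 : ∀ n → P n ≡ + 0 × K n ≡ + 0
    PK≡0 = linear-system-zero P K (emb (+ 0)) Q (emb (- (+ 2))) W P₀ K₀ D-P D-K

  B₁′ : EGF
  B₁′ = (Z ⊕ B₁ ⊕ (Z ⊛ A) ⊕ (A ⊛ Z) ⊕ (B₁ ⊛ A) ⊕ (A ⊛ B₁)) ⊕ negE (Z ⊛ Z)

  D-B₁ : D B₁ ≋ B₁′
  D-B₁ = begin
    D B₁                               ≈⟨ solve 2 (λ x z → x := (x :+ z :* z) :+ :- (z :* z)) ≋-refl (D B₁) Z ⟩
    (D B₁ ⊕ (Z ⊛ Z)) ⊕ negE (Z ⊛ Z)    ≈⟨ ⊕-cong rank1-ode (≋-refl {negE (Z ⊛ Z)}) ⟩
    B₁′                                ∎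

  z² : List ℤ
  z² = + 0 ∷ + 0 ∷ + 1 ∷ []

  -- Any series A′ equal to A may be used (in the theorem it is B - 1).
  B₁-ode : ∀ A′ → A′ ≋ A → D B₁ ≋ (+ 2 · (B₁ ⊛ A′) ⊕ B₁ ⊕ + 2 · (Z ⊛ A′) ⊕ Z ⊖ poly z²)
  B₁-ode A′ A′≋A = begin
    D B₁ ≈⟨ D-B₁ ⟩
    B₁′  ≈⟨ solve 3 (λ b a z → (z :+ b :+ z :* a :+ a :* z :+ b :* a :+ a :* b) :+ :- (z :* z)
                     := con (+ 2) :* (b :* a) :+ b :+ con (+ 2) :* (z :* a) :+ z :+ :- hornerₚ z² z) ≋-refl B₁ A Z ⟩
    emb (+ 2) ⊛ (B₁ ⊛ A) ⊕ B₁ ⊕ emb (+ 2) ⊛ (Z ⊛ A) ⊕ Z ⊕ negE (horner z²)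
      ≈⟨ ≋-sym (⊕-cong (⊕-cong (⊕-cong (⊕-cong (scaled B₁) (≋-refl {B₁})) (scaled Z)) (≋-refl {Z}))
                       (negE-cong (poly-as-horner z²))) ⟩
    (+ 2 · (B₁ ⊛ A′) ⊕ B₁ ⊕ + 2 · (Z ⊛ A′) ⊕ Z ⊖ poly z²) ∎
    where
    scaled : ∀ f → + 2 · (f ⊛ A′) ≋ emb (+ 2) ⊛ (f ⊛ A)
    scaled f = ≋-trans (·-as-⊛ (+ 2) (f ⊛ A′)) (⊛-cong (≋-refl {emb (+ 2)}) (⊛-cong (≋-refl {f}) A′≋A))

  -- The closed form: B₁ · 9g = N with N the numerator of the theorem.
  -- H = B₁ · 9g - N satisfies H′ = 9 (B₁ + z) K = 0 and H(0) = 0.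

  n₃ n₂ n₁ : List ℤ
  n₃ = + 0 ∷ + 0 ∷ + 0 ∷ + 6 ∷ []
  n₂ = - (+ 5) ∷ - (+ 15) ∷ + 3 ∷ []
  n₁ = - (+ 5) ∷ + 5 ∷ + 3 ∷ []

  N : EGF
  N = horner n₃ ⊕ (horner n₂ ⊛ sqrt3Sin) ⊕ (emb (+ 3) ⊛ (horner n₁ ⊛ cosSqrt3)) ⊕ emb (+ 15)

  H : EGF
  H = (B₁ ⊛ (emb (+ 9) ⊛ g)) ⊕ negE N

  N′ : EGF
  N′ = hornerD n₃ ⊕ ((hornerD n₂ ⊛ sqrt3Sin) ⊕ (horner n₂ ⊛ (emb (+ 3) ⊛ cosSqrt3)))
       ⊕ ((emb (+ 0) ⊛ (horner n₁ ⊛ cosSqrt3)) ⊕ (emb (+ 3) ⊛ ((hornerD n₁ ⊛ cosSqrt3) ⊕ (horner n₁ ⊛ negE sqrt3Sin))))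
       ⊕ emb (+ 0)

  D-N : D N ≋ N′
  D-N = D-⊕ (horner n₃ ⊕ (horner n₂ ⊛ sqrt3Sin) ⊕ (emb (+ 3) ⊛ (horner n₁ ⊛ cosSqrt3))) (emb (+ 15))
          (D-⊕ (horner n₃ ⊕ (horner n₂ ⊛ sqrt3Sin)) (emb (+ 3) ⊛ (horner n₁ ⊛ cosSqrt3))
             (D-⊕ (horner n₃) (horner n₂ ⊛ sqrt3Sin) (D-horner n₃) (D-⊛ (horner n₂) sqrt3Sin (D-horner n₂) D-sqrt3Sin))
             (D-⊛ (emb (+ 3)) (horner n₁ ⊛ cosSqrt3) (D-emb (+ 3)) (D-⊛ (horner n₁) cosSqrt3 (D-horner n₁) D-cosSqrt3)))
          (D-emb (+ 15))

  D-H : D H ≋ (emb (+ 9) ⊛ (B₁ ⊕ Z)) ⊛ K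
  D-H = begin
    D H
      ≈⟨ D-⊕ (B₁ ⊛ (emb (+ 9) ⊛ g)) (negE N)
           (D-⊛ B₁ (emb (+ 9) ⊛ g) D-B₁ (D-⊛ (emb (+ 9)) g (D-emb (+ 9)) D-g)) (D-negE N D-N) ⟩
    (B₁′ ⊛ (emb (+ 9) ⊛ g) ⊕ B₁ ⊛ (emb (+ 0) ⊛ g ⊕ emb (+ 9) ⊛ g′)) ⊕ negE N′
      ≈⟨ solve 5 (λ b a z s c →
           let gₚ  = s :+ :- c :+ :- con (+ 2)
               g′ₚ = con (+ 3) :* c :+ s
               w   = con (+ 1) :+ con (+ 2) :* a
               b₁′ = (z :+ b :+ z :* a :+ a :* z :+ b :* a :+ a :* b) :+ :- (z :* z)
               n′  = hornerDₚ n₃ z :+ ((hornerDₚ n₂ z :* s) :+ (hornerₚ n₂ z :* (con (+ 3) :* c)))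
                     :+ ((con (+ 0) :* (hornerₚ n₁ z :* c)) :+ (con (+ 3) :* ((hornerDₚ n₁ z :* c) :+ (hornerₚ n₁ z :* (:- s)))))
                     :+ con (+ 0)
           in (b₁′ :* (con (+ 9) :* gₚ) :+ b :* (con (+ 0) :* gₚ :+ con (+ 9) :* g′ₚ)) :+ :- n′
              := (con (+ 9) :* (b :+ z)) :* (w :* gₚ :+ g′ₚ))
         ≋-refl B₁ A Z sqrt3Sin cosSqrt3 ⟩
    (emb (+ 9) ⊛ (B₁ ⊕ Z)) ⊛ K ∎

  H≋0 : H ≋ emb (+ 0)
  H≋0 = D-zero⇒zero H H₀ (begin
    D H                                    ≈⟨ D-H ⟩
    (emb (+ 9) ⊛ (B₁ ⊕ Z)) ⊛ K             ≈⟨ ⊛-cong (≋-refl {emb (+ 9) ⊛ (B₁ ⊕ Z)}) K≋0 ⟩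
    (emb (+ 9) ⊛ (B₁ ⊕ Z)) ⊛ emb (+ 0)     ≈⟨ solve 1 (λ x → x :* con (+ 0) := con (+ 0)) ≋-refl (emb (+ 9) ⊛ (B₁ ⊕ Z)) ⟩
    emb (+ 0)                              ∎)
    where
    H₀ : H 0 ≡ + 0
    H₀ = cong (λ y → y + - N 0) (trans (⊛-at-0 B₁ (emb (+ 9) ⊛ g)) (cong (_* (emb (+ 9) ⊛ g) 0) B₁₀))

  B₁-closed-form : (B₁ ⊛ (+ 9 · (sqrt3Sin ⊖ cosSqrt3 ⊖ const (+ 2))))
    ≋ (poly n₃ ⊕ poly n₂ ⊛ sqrt3Sin ⊕ + 3 · (poly n₁ ⊛ cosSqrt3) ⊕ const (+ 15))
  B₁-closed-form = begin
    B₁ ⊛ (+ 9 · (sqrt3Sin ⊖ cosSqrt3 ⊖ const (+ 2)))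
      ≈⟨ ⊛-cong (≋-refl {B₁}) (≋-trans (·-as-⊛ (+ 9) _)
           (⊛-cong (≋-refl {emb (+ 9)}) (⊕-cong (≋-refl {sqrt3Sin ⊕ negE cosSqrt3}) (negE-cong (const-as-emb (+ 2)))))) ⟩
    B₁ ⊛ (emb (+ 9) ⊛ g)
      ≈⟨ solve 2 (λ x y → x := (x :+ :- y) :+ y) ≋-refl (B₁ ⊛ (emb (+ 9) ⊛ g)) N ⟩
    H ⊕ N
      ≈⟨ ⊕-cong H≋0 (≋-refl {N}) ⟩
    emb (+ 0) ⊕ N
      ≈⟨ solve 1 (λ x → con (+ 0) :+ x := x) ≋-refl N ⟩
    N
      ≈⟨ ≋-sym (⊕-cong (⊕-cong (⊕-cong (poly-as-horner n₃) (⊛-cong (poly-as-horner n₂) (≋-refl {sqrt3Sin})))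
                               (≋-trans (·-as-⊛ (+ 3) _) (⊛-cong (≋-refl {emb (+ 3)}) (⊛-cong (poly-as-horner n₁) (≋-refl {cosSqrt3})))))
                       (const-as-emb (+ 15))) ⟩
    poly n₃ ⊕ poly n₂ ⊛ sqrt3Sin ⊕ + 3 · (poly n₁ ⊛ cosSqrt3) ⊕ const (+ 15) ∎

theorem3p2 : (E : (n : ℕ) → Enumeration n) →
    let B  = fromℕseq (bSeq E)
        B₁ = fromℕseq (b1Seq E)
    in ((∀ n → D B₁ n ≡ (+ 2 · (B₁ ⊛ (B ⊖ const (+ 1)))
                          ⊕ B₁
                          ⊕ + 2 · (Z ⊛ (B ⊖ const (+ 1)))
                          ⊕ Z
                          ⊖ poly (+ 0 ∷ + 0 ∷ + 1 ∷ [])) n)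
        × B₁ 0 ≡ + 0)
     × (∀ n → (B₁ ⊛ (+ 9 · (sqrt3Sin ⊖ cosSqrt3 ⊖ const (+ 2)))) n
              ≡ (poly (+ 0 ∷ + 0 ∷ + 0 ∷ + 6 ∷ [])
                 ⊕ poly (- (+ 5) ∷ - (+ 15) ∷ + 3 ∷ []) ⊛ sqrt3Sin
                 ⊕ + 3 · (poly (- (+ 5) ∷ + 5 ∷ + 3 ∷ []) ⊛ cosSqrt3)
                 ⊕ const (+ 15)) n)
theorem3p2 E = (at (B₁-ode (fromℕseq (bSeq E) ⊖ const (+ 1)) B-1≋A) , B₁-at-0) , at B₁-closed-form
  where
  open Recurrences E
  open Solution A (fromℕseq (b1Seq E)) A-at-0 B₁-at-0 count-ode (rank1-ode (fromℕseq (b1Seq E)) B₁≋total)
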